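{- Let $(G,G')$ be a pair isomorphic to $(K_4,P_4)$ with vertices $i,i+1,i+2,i+3$, where $G'$ is the path $i\!-\!(i+1)\!-\!(i+2)\!-\!(i+3)$, let $\langle T,\mathcal P\rangle$ be a representation of it, and let $\bigcap\mathcal P_K:=P_i\cap P_{i+1}\cap P_{i+2}\cap P_{i+3}$. There is a path $core(K)$ of $T$ with endpoints $u,v$ such that: (i) $\mathrm{split}(P_i,P_{i+2})=\{u\}$, $\mathrm{split}(P_{i+1},P_{i+3})=\{v\}$, $P_{i+1}$ does not cross $u$ and $P_{i+2}$ does not cross $v$; (ii) $\emptyset\neq\bigcap\mathcal P_K\subseteq P_{i+1}\cap P_{i+2}\subseteq core(K)$; in particular $u\neq v$; (iii) at least one of $P_i,P_{i+3}$ crosses both endpoints of $core(K)$, and $\emptyset\neq\mathrm{split}(P_i,P_{i+3})\subseteq\{u,v\}$; (iv) $P_{i+1}\cup P_{i+2}$ crosses both endpoints of $core(K)$; (v) the removal of the edges of $P_{i+1}\cup P_{i+2}$ from $T$ disconnects $P_i$ from $P_{i+3}$.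
   Context: A representation $\langle T,\mathcal P\rangle$: a tree $T$ and a family $\mathcal P=(P_v)$ of simple paths of $T$ with at least one edge. Paths intersect if they share an edge; intersections of paths are taken as edge sets. $\mathrm{split}(P,P')$ is the set of vertices of degree $\ge3$ in $P\cup P'$; $P\sim P'$ means intersecting with empty split set. It represents $(G,G')$ if $uv\in E(G)$ iff $P_u,P_v$ intersect and $uv\in E(G')$ iff $P_u\sim P_v$. A path $P$ crosses a vertex $w$ if $w$ is an internal (non-end) vertex of $P$. -}

module Defs where

open import Data.Nat using (ℕ; _≤_; _+_)
open import Data.Fin using (Fin; toℕ)
open import Data.Bool using (Bool; true; false)
open import Data.List using (List; []; _∷_; length; _++_; [_])
open import Data.List.Relation.Unary.Linked using (Linked)
open import Data.List.Relation.Unary.Unique.Propositional using (Unique)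
open import Data.Product using (Σ; ∃; ∃-syntax; _×_; _,_)
open import Data.Sum using (_⊎_)
open import Relation.Binary.PropositionalEquality using (_≡_; _≢_)
open import Relation.Nullary using (¬_)
open import Function.Bundles using (_⇔_)

data Reach {V : Set} (R : V → V → Set) : V → V → Set where
  here  : ∀ {x} → Reach R x x
  there : ∀ {x y z} → R x y → Reach R y z → Reach R x z

data Consec {V : Set} : List V → V → V → Set where
  now   : ∀ {x y xs} → Consec (x ∷ y ∷ xs) x y
  later : ∀ {z xs x y} → Consec xs x y → Consec (z ∷ xs) x y

lastOf : {V : Set} → V → List V → V
lastOf x []       = x
lastOf x (y ∷ ys) = lastOf y ys

record Cycle {n : ℕ} (Adj : Fin n → Fin n → Set) : Set where
  field
    first   : Fin n
    rest    : List (Fin n)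
    long    : 2 ≤ length rest
    unique  : Unique (first ∷ rest)
    closed  : Linked Adj (first ∷ rest ++ [ first ])

record Tree (n : ℕ) : Set where
  field
    adj       : Fin n → Fin n → Bool
    adj-sym   : ∀ x y → adj x y ≡ adj y x
    adj-irr   : ∀ x → adj x x ≡ false
  Adj : Fin n → Fin n → Set
  Adj x y = adj x y ≡ true
  field
    connected : ∀ x y → Reach Adj x y
    acyclic   : ¬ Cycle Adj

open Tree public using (Adj)

record Path {n : ℕ} (T : Tree n) : Set where
  field
    first    : Fin n
    rest     : List (Fin n)
    oneEdge  : 1 ≤ length rest
    unique   : Unique (first ∷ rest)
    linked   : Linked (Adj T) (first ∷ rest)

  verts : List (Fin n)
  verts = first ∷ rest

  final : Fin n
  final = lastOf first rest

module _ {n : ℕ} {T : Tree n} where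

  EdgeOf : Path T → Fin n → Fin n → Set
  EdgeOf P x y = Consec (Path.verts P) x y ⊎ Consec (Path.verts P) y x

  EdgeOf∪ : Path T → Path T → Fin n → Fin n → Set
  EdgeOf∪ P Q x y = EdgeOf P x y ⊎ EdgeOf Q x y

  Intersect : Path T → Path T → Set
  Intersect P Q = ∃[ x ] ∃[ y ] (EdgeOf P x y × EdgeOf Q x y)

  Split : Path T → Path T → Fin n → Set
  Split P Q w = ∃[ a ] ∃[ b ] ∃[ c ]
    (a ≢ b × a ≢ c × b ≢ c ×
     EdgeOf∪ P Q w a × EdgeOf∪ P Q w b × EdgeOf∪ P Q w c)

  _∼_ : Path T → Path T → Set
  P ∼ Q = Intersect P Q × (∀ w → ¬ Split P Q w)

  Crosses : Path T → Fin n → Set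
  Crosses P w = ∃[ a ] ∃[ b ] (Consec (Path.verts P) a w × Consec (Path.verts P) w b)

  Crosses∪ : Path T → Path T → Fin n → Set
  Crosses∪ P Q w = Σ (Path T) λ R →
    (∀ x y → EdgeOf R x y ⇔ EdgeOf∪ P Q x y) × Crosses R w

  Represents : {V : Set} → (V → Path T) → (V → V → Set) → (V → V → Set) → Set
  Represents {V} 𝒫 E E' = ∀ (a b : V) → a ≢ b →
    (E a b ⇔ Intersect (𝒫 a) (𝒫 b)) × (E' a b ⇔ (𝒫 a ∼ 𝒫 b))

-- The pair (K₄, P₄) on vertices 0,1,2,3 (standing for i,i+1,i+2,i+3),
-- G' being the path 0 - 1 - 2 - 3.

K₄ : Fin 4 → Fin 4 → Set
K₄ a b = a ≢ b

P₄ : Fin 4 → Fin 4 → Set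
P₄ a b = (toℕ a + 1 ≡ toℕ b) ⊎ (toℕ b + 1 ≡ toℕ a)

-- Let u be the split vertex of P₀, P₂ and v that of P₁, P₃.  Around u the paths form a star with
-- three rays: P₀ uses x, y and P₂ uses y, z, while P₀ ∼ P₁ ∼ P₂ ∼ P₃ leaves P₁ only y and P₃ only
-- y, z; at v the same holds with P₃, P₂ in the roles of P₀, P₁.  As T is a tree, every vertex other
-- than u lies in exactly one branch at u, so the two stars locate every vertex of every path.  The
-- core is the u–v path; it lies in P₁ ∪ P₂ and contains P₁ ∩ P₂.  A second split of P₀, P₂, or a
-- split of P₀, P₃ off {u, v}, would make P₁ or P₂ use two rays at a core vertex and so split from a
-- neighbour.  The edges of P₀ off P₁ ∪ P₂ lie on the x side of u or behind the ray of P₁ at v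
-- pointing away from u, those of P₃ symmetrically, and a walk avoiding the edges of P₁ ∪ P₂ cannot
-- pass between these regions.

module Submission where

open import Defs
open import Data.Nat using (ℕ; s≤s; z≤n)
open import Data.Fin using (Fin; zero; suc) renaming (_≟_ to _≟F_)
open import Data.Fin.Patterns using (0F; 1F; 2F; 3F)
open import Data.Fin.Properties using (any?)
open import Data.List using (List; []; _∷_; _++_; [_])
open import Data.List.Relation.Unary.Linked as Linked using (Linked; []; [-]; _∷_)
open import Data.List.Relation.Unary.Unique.Propositional using (Unique)
open import Data.List.Relation.Unary.AllPairs using ([]; _∷_)
open import Data.List.Relation.Unary.All as All using (All; []; _∷_)
open import Data.List.Relation.Unary.All.Properties using (¬Any⇒All¬)
open import Data.List.Relation.Unary.Any using () renaming (here to ahere; there to athere)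
open import Data.List.Membership.Propositional using (_∈_)
open import Data.Product using (Σ; ∃-syntax; _×_; _,_; proj₁; proj₂)
open import Data.Sum using (_⊎_; inj₁; inj₂; [_,_]′)
open import Data.Empty using (⊥; ⊥-elim)
open import Relation.Nullary using (¬_; yes; no; Dec)
open import Relation.Nullary.Decidable using (_×-dec_; _⊎-dec_; ¬?)
open import Relation.Binary.Definitions using (DecidableEquality)
open import Relation.Binary.PropositionalEquality using (_≡_; _≢_; refl; sym; trans; subst)
open import Function.Bundles using (_⇔_; mk⇔; Equivalence)

module _ {V : Set} {R : V → V → Set} where

  reach-trans : ∀ {x y z} → Reach R x y → Reach R y z → Reach R x z
  reach-trans here q = q
  reach-trans (there r p) q = there r (reach-trans p q)

  reach-sym : (∀ {a b} → R a b → R b a) → ∀ {x y} → Reach R x y → Reach R y x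
  reach-sym s here = here
  reach-sym s (there r p) = reach-trans (reach-sym s p) (there (s r) here)

  reach-map : ∀ {S : V → V → Set} → (∀ {a b} → R a b → S a b) → ∀ {x y} → Reach R x y → Reach S x y
  reach-map f here = here
  reach-map f (there r p) = there (f r) (reach-map f p)

  linked-snoc : ∀ {h t y} → Linked R (h ∷ t) → R (lastOf h t) y → Linked R (h ∷ t ++ [ y ])
  linked-snoc {t = []} [-] r = r ∷ [-]
  linked-snoc {t = _ ∷ _} (r₀ ∷ l) r = r₀ ∷ linked-snoc l r

  consec-related : ∀ {xs a b} → Linked R xs → Consec xs a b → R a b
  consec-related (r ∷ l) now = r
  consec-related (r ∷ l) (later c) = consec-related l c
  consec-related [-] (later ())

module _ {V : Set} where

  Edge : List V → V → V → Set
  Edge xs a b = Consec xs a b ⊎ Consec xs b a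

  all≢⇒∉ : ∀ {x : V} {ys} → All (x ≢_) ys → x ∈ ys → ⊥
  all≢⇒∉ al m = All.lookup al m refl

  consec-∈₁ : ∀ {xs : List V} {a b} → Consec xs a b → a ∈ xs
  consec-∈₁ now = ahere refl
  consec-∈₁ (later c) = athere (consec-∈₁ c)

  consec-∈₂ : ∀ {xs : List V} {a b} → Consec xs a b → b ∈ xs
  consec-∈₂ now = athere (ahere refl)
  consec-∈₂ (later c) = athere (consec-∈₂ c)

  consec-∈tail : ∀ {x : V} {xs a b} → Consec (x ∷ xs) a b → b ∈ xs
  consec-∈tail now = ahere refl
  consec-∈tail (later c) = consec-∈₂ c

  consec-pred-unique : ∀ {xs : List V} {a a' w} → Unique xs → Consec xs a w → Consec xs a' w → a ≡ a'
  consec-pred-unique u now now = refl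
  consec-pred-unique (_ ∷ al ∷ u) now (later c) = ⊥-elim (all≢⇒∉ al (consec-∈tail c))
  consec-pred-unique (_ ∷ al ∷ u) (later c) now = ⊥-elim (all≢⇒∉ al (consec-∈tail c))
  consec-pred-unique (_ ∷ u) (later c) (later c') = consec-pred-unique u c c'

  consec-succ-unique : ∀ {xs : List V} {b b' w} → Unique xs → Consec xs w b → Consec xs w b' → b ≡ b'
  consec-succ-unique u now now = refl
  consec-succ-unique (al ∷ u) now (later c) = ⊥-elim (all≢⇒∉ al (consec-∈₁ c))
  consec-succ-unique (al ∷ u) (later c) now = ⊥-elim (all≢⇒∉ al (consec-∈₁ c))
  consec-succ-unique (_ ∷ u) (later c) (later c') = consec-succ-unique u c c'

  consec-asym : ∀ {xs : List V} {a w} → Unique xs → Consec xs a w → Consec xs w a → ⊥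
  consec-asym (al ∷ u) now now = All.head al refl
  consec-asym (al ∷ u) now (later c) = all≢⇒∉ al (consec-∈₂ c)
  consec-asym (al ∷ u) (later c) now = all≢⇒∉ al (consec-∈₂ c)
  consec-asym (_ ∷ u) (later c) (later c') = consec-asym u c c'

  edge-there : ∀ {x : V} {xs a b} → Edge xs a b → Edge (x ∷ xs) a b
  edge-there (inj₁ c) = inj₁ (later c)
  edge-there (inj₂ c) = inj₂ (later c)

  degree≤2 : ∀ {xs : List V} {w a b c} → Unique xs → Edge xs w a → Edge xs w b → Edge xs w c →
             a ≢ b → a ≢ c → b ≢ c → ⊥
  degree≤2 u (inj₁ x) (inj₁ y) _ ab ac bc = ab (consec-succ-unique u x y)
  degree≤2 u (inj₂ x) (inj₂ y) _ ab ac bc = ab (consec-pred-unique u x y)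
  degree≤2 u (inj₁ x) (inj₂ y) (inj₁ z) ab ac bc = ac (consec-succ-unique u x z)
  degree≤2 u (inj₁ x) (inj₂ y) (inj₂ z) ab ac bc = bc (consec-pred-unique u y z)
  degree≤2 u (inj₂ x) (inj₁ y) (inj₁ z) ab ac bc = bc (consec-succ-unique u y z)
  degree≤2 u (inj₂ x) (inj₁ y) (inj₂ z) ab ac bc = ac (consec-pred-unique u x z)

  two-edges⇒inner : ∀ {xs : List V} {w a b} → Unique xs → Edge xs w a → Edge xs w b → a ≢ b →
                    Σ V λ p → Σ V λ s → Consec xs p w × Consec xs w s
  two-edges⇒inner u (inj₁ x) (inj₁ y) ne = ⊥-elim (ne (consec-succ-unique u x y))
  two-edges⇒inner u (inj₂ x) (inj₂ y) ne = ⊥-elim (ne (consec-pred-unique u x y))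
  two-edges⇒inner u (inj₁ x) (inj₂ y) ne = _ , _ , y , x
  two-edges⇒inner u (inj₂ x) (inj₁ y) ne = _ , _ , x , y

  head-no-pred : ∀ {x : V} {xs a} → Unique (x ∷ xs) → Consec (x ∷ xs) a x → ⊥
  head-no-pred (al ∷ u) c = all≢⇒∉ al (consec-∈tail c)

  lastOf-∈ : ∀ (x : V) xs → lastOf x xs ∈ (x ∷ xs)
  lastOf-∈ x [] = ahere refl
  lastOf-∈ x (y ∷ ys) = athere (lastOf-∈ y ys)

  last-no-succ : ∀ {x : V} {xs l b} → Unique (x ∷ xs) → lastOf x xs ≡ l → Consec (x ∷ xs) l b → ⊥
  last-no-succ {xs = []} u e (later ())
  last-no-succ {xs = y ∷ ys} (al ∷ u) e now = all≢⇒∉ al (subst (_∈ (y ∷ ys)) e (lastOf-∈ y ys))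
  last-no-succ {xs = y ∷ ys} (al ∷ u) e (later c) = last-no-succ u e c

module _ {V : Set} (_≟_ : DecidableEquality V) where
  open import Data.List.Membership.DecPropositional _≟_ using (_∈?_)

  consec? : ∀ (xs : List V) a b → Dec (Consec xs a b)
  consec? [] a b = no (λ ())
  consec? (x ∷ []) a b = no (λ { (later ()) })
  consec? (x ∷ y ∷ xs) a b with x ≟ a | y ≟ b | consec? (y ∷ xs) a b
  ... | yes refl | yes refl | _ = yes now
  ... | _ | _ | yes c = yes (later c)
  ... | no xa | _ | no nc = no λ { now → xa refl ; (later c) → nc c }
  ... | yes _ | no yb | no nc = no λ { now → yb refl ; (later c) → nc c }

  SimpleWalk : (V → V → Set) → V → V → Set
  SimpleWalk R x y = Σ (List V) λ t → Unique (x ∷ t) × Linked R (x ∷ t) × lastOf x t ≡ y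

  suffix-walk : ∀ {R : V → V → Set} {x h z} t → x ∈ (h ∷ t) → Unique (h ∷ t) → Linked R (h ∷ t) →
                lastOf h t ≡ z → SimpleWalk R x z
  suffix-walk t (ahere refl) u l e = t , u , l , e
  suffix-walk (_ ∷ t) (athere m) (_ ∷ u) l e = suffix-walk t m u (Linked.tail l) e

  -- loop erasure: a revisited vertex cuts the walk back to its first occurrence
  simpleWalk-cons : ∀ {R : V → V → Set} {x y z} → R x y → SimpleWalk R y z → SimpleWalk R x z
  simpleWalk-cons {x = x} {y} r (t , u , l , e) with x ∈? (y ∷ t)
  ... | yes m = suffix-walk t m u l e
  ... | no ¬m = (y ∷ t) , (¬Any⇒All¬ _ ¬m ∷ u) , (r ∷ l) , e

  reach⇒simpleWalk : ∀ {R : V → V → Set} {x y} → Reach R x y → SimpleWalk R x y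
  reach⇒simpleWalk here = [] , ([] ∷ []) , [-] , refl
  reach⇒simpleWalk (there r p) = simpleWalk-cons r (reach⇒simpleWalk p)

  reach-or-meets : ∀ {R : V → V → Set} m {x y} → Reach R x y →
                   Reach (λ a b → R a b × a ≢ m × b ≢ m) x y ⊎ Reach R x m
  reach-or-meets m {x} here with x ≟ m
  ... | yes refl = inj₂ here
  ... | no _ = inj₁ here
  reach-or-meets m {x} (there {y = y} r p) with x ≟ m
  ... | yes refl = inj₂ here
  ... | no xm with reach-or-meets m p
  ...   | inj₂ q = inj₂ (there r q)
  ...   | inj₁ q with y ≟ m
  ...     | yes refl = inj₂ (there r here)
  ...     | no ym = inj₁ (there (r , xm , ym) q)

module _ {n : ℕ} (T : Tree n) where
  open import Data.List.Membership.DecPropositional (_≟F_ {n}) using (_∈?_)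
  V : Set
  V = Fin n
  Nbr : V → V → Set
  Nbr = Adj T

  nbr-sym : ∀ {a b} → Nbr a b → Nbr b a
  nbr-sym {a} {b} p = trans (Tree.adj-sym T b a) p

  nbr-irrefl : ∀ {a b} → Nbr a b → a ≢ b
  nbr-irrefl {a} p refl with trans (sym p) (Tree.adj-irr T a)
  ... | ()

  NbrAvoiding : V → V → V → Set
  NbrAvoiding w a b = Nbr a b × a ≢ w × b ≢ w

  nbrAvoiding-sym : ∀ {w a b} → NbrAvoiding w a b → NbrAvoiding w b a
  nbrAvoiding-sym (r , p , q) = nbr-sym r , q , p

  Branch : V → V → V → Set
  Branch w c m = Reach (NbrAvoiding w) c m

  avoiding⇒all≢ : ∀ {w c t} → c ≢ w → Linked (NbrAvoiding w) (c ∷ t) → All (w ≢_) (c ∷ t)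
  avoiding⇒all≢ ne [-] = (λ e → ne (sym e)) ∷ []
  avoiding⇒all≢ ne (r ∷ l) = (λ e → ne (sym e)) ∷ avoiding⇒all≢ (proj₂ (proj₂ r)) l

  -- Acyclicity of T enters only here: a walk from c to c' avoiding w closes a cycle through w.
  branch-distinct : ∀ {w c c'} → Nbr w c → Nbr w c' → c ≢ c' → Branch w c c' → ⊥
  branch-distinct {w} {c} {c'} ac ac' ne p with reach⇒simpleWalk _≟F_ p
  ... | [] , u , l , e = ne e
  ... | (h2 ∷ t) , u , l , e = Tree.acyclic T record
    { first = w ; rest = c ∷ h2 ∷ t ; long = s≤s (s≤s z≤n)
    ; unique = avoiding⇒all≢ (λ q → nbr-irrefl ac (sym q)) l ∷ u
    ; closed = ac ∷ linked-snoc (Linked.map proj₁ l) (subst (λ z → Nbr z w) (sym e) (nbr-sym ac')) }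

  avoiding-source≢ : ∀ {w x m} → Reach (NbrAvoiding w) x m → m ≢ w → x ≢ w
  avoiding-source≢ here ne = ne
  avoiding-source≢ (there r _) _ = proj₁ (proj₂ r)

  branch-or-avoiding : ∀ {w a m} → Reach Nbr a m → m ≢ w → Reach (NbrAvoiding w) a m ⊎ Σ V λ c → Nbr w c × Branch w c m
  branch-or-avoiding here ne = inj₁ here
  branch-or-avoiding {w} {a} (there r p) ne with branch-or-avoiding p ne
  ... | inj₂ q = inj₂ q
  ... | inj₁ q with a ≟F w
  ...   | yes refl = inj₂ (_ , r , q)
  ...   | no a≢w = inj₁ (there (r , a≢w , avoiding-source≢ q ne) q)

  branch-exists : ∀ {w m} → m ≢ w → Σ V λ c → Nbr w c × Branch w c m
  branch-exists {w} {m} ne with branch-or-avoiding {w} (Tree.connected T w m) ne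
  ... | inj₁ q = ⊥-elim (avoiding-source≢ q ne refl)
  ... | inj₂ q = q

  branch-unique : ∀ {w c c' m} → Nbr w c → Nbr w c' → Branch w c m → Branch w c' m → c ≡ c'
  branch-unique {c = c} {c'} ac ac' p q with c ≟F c'
  ... | yes e = e
  ... | no ne = ⊥-elim (branch-distinct ac ac' ne (reach-trans p (reach-sym nbrAvoiding-sym q)))

  avoiding-target≢ : ∀ {w x m} → Reach (NbrAvoiding w) x m → x ≢ w → m ≢ w
  avoiding-target≢ here ne = ne
  avoiding-target≢ (there r p) _ = avoiding-target≢ p (proj₂ (proj₂ r))

  branch≢centre : ∀ {w c m} → Nbr w c → Branch w c m → m ≢ w
  branch≢centre ac p = avoiding-target≢ p (λ e → nbr-irrefl ac (sym e))

  branch-common : ∀ {u a b c m} → Branch u a m ⊎ Branch u b m → Branch u b m ⊎ Branch u c m → Nbr u a → Nbr u c → a ≢ c → Branch u b m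
  branch-common (inj₂ p) _ _ _ _ = p
  branch-common (inj₁ _) (inj₁ q) _ _ _ = q
  branch-common (inj₁ p) (inj₂ q) aa ac ne = ⊥-elim (ne (branch-unique aa ac p q))

  branch-around : ∀ {v k a m} → Nbr v k → Branch v k a → ¬ Branch v k m → m ≢ v → Reach (NbrAvoiding m) v a
  branch-around {v} {k} {a} {m} ak p nm mv with reach-or-meets _≟F_ m p
  ... | inj₂ q = ⊥-elim (nm q)
  ... | inj₁ q = there (ak , (λ e → mv (sym e)) , (λ e → nm (subst (Branch v k) e here)))
                       (reach-map (λ { ((r , _ , _) , am , bm) → r , am , bm }) q)

  off-walk-keeps-branch : ∀ (F : V → V → Set) {s t a c} → F s t → Nbr s t →
                          Reach (λ x y → Nbr x y × ¬ F x y) a c → Branch s t c → Branch s t a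
  off-walk-keeps-branch F f st here c = c
  off-walk-keeps-branch F {s} {t} {a} f st (there (ab , ¬fab) p) c with off-walk-keeps-branch F f st p c | a ≟F s
  ... | b∈Bt | yes refl = ⊥-elim (¬fab (subst (F a) (sym (branch-unique ab st here b∈Bt)) f))
  ... | b∈Bt | no a≢s = reach-trans b∈Bt (there (nbr-sym ab , branch≢centre st b∈Bt , a≢s) here)

  reach-from-head : ∀ {x : V} {xs w m} → Linked Nbr (x ∷ xs) → All (w ≢_) (x ∷ xs) → m ∈ (x ∷ xs) → Reach (NbrAvoiding w) x m
  reach-from-head l al (ahere refl) = here
  reach-from-head {xs = y ∷ ys} (r ∷ l) (a1 ∷ al) (athere mm) =
    there (r , (λ e → a1 (sym e)) , (λ e → All.head al (sym e))) (reach-from-head l al mm)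

  avoiding-list-connected : ∀ {xs : List V} {w m m'} → ¬ (w ∈ xs) → Linked Nbr xs → m ∈ xs → m' ∈ xs → Reach (NbrAvoiding w) m m'
  avoiding-list-connected {x ∷ xs} {w} nwm l mm mm' = reach-trans (reach-sym nbrAvoiding-sym (reach-from-head l al mm)) (reach-from-head l al mm')
    where
    al : All (w ≢_) (x ∷ xs)
    al = ¬Any⇒All¬ (x ∷ xs) nwm

  edge⇒nbr : ∀ {xs : List V} {w c} → Linked Nbr xs → Edge xs w c → Nbr w c
  edge⇒nbr l (inj₁ c) = consec-related l c
  edge⇒nbr l (inj₂ c) = nbr-sym (consec-related l c)

  edge-toward-exists : ∀ {xs : List V} {w m} → Unique xs → Linked Nbr xs → w ∈ xs → m ∈ xs → m ≢ w →
        Σ V λ c → Edge xs w c × Branch w c m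
  edge-toward-exists u l (ahere refl) (ahere refl) ne = ⊥-elim (ne refl)
  edge-toward-exists {x ∷ (y ∷ ys)} (ux ∷ u) (r ∷ l) (ahere refl) (athere mm) ne = y , inj₁ now , reach-from-head l ux mm
  edge-toward-exists {x ∷ (y ∷ ys)} {w} (ux ∷ u) (r ∷ l) (athere ww) (ahere refl) ne with w ≟F y
  ... | yes refl = x , inj₂ now , here
  ... | no w≢y with edge-toward-exists u l ww (ahere refl) (λ e → w≢y (sym e))
  ...   | c , e , q = c , edge-there e , reach-trans q (there (nbr-sym r , (λ e → w≢y (sym e)) , ne) here)
  edge-toward-exists (_ ∷ u) l (athere ww) (athere mm) ne with edge-toward-exists u (Linked.tail l) ww mm ne
  ... | c , e , q = c , edge-there e , q

  edge-toward : ∀ {xs : List V} {w m c} → Unique xs → Linked Nbr xs → w ∈ xs → m ∈ xs → m ≢ w → Nbr w c → Branch w c m → Edge xs w c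
  edge-toward {xs} {w} u l wm mm ne ac p with edge-toward-exists u l wm mm ne
  ... | c' , e , q = subst (λ k → Edge xs w k) (sym (branch-unique ac (edge⇒nbr l e) p q)) e

  edges-toward : ∀ {xs : List V} {w a b c c'} → Unique xs → Linked Nbr xs → a ∈ xs → b ∈ xs → a ≢ w → b ≢ w →
         Nbr w c → Nbr w c' → c ≢ c' → Branch w c a → Branch w c' b → Edge xs w c × Edge xs w c'
  edges-toward {xs} {w} u l am bm aw bw ac ac' ne pa pb with w ∈? xs
  ... | yes wm = edge-toward u l wm am aw ac pa , edge-toward u l wm bm bw ac' pb
  ... | no nwm = ⊥-elim (ne (branch-unique ac ac' (reach-trans pa (avoiding-list-connected nwm l am bm)) pb))

  nbr⇒edge : ∀ {xs : List V} {a b} → Unique xs → Linked Nbr xs → a ∈ xs → b ∈ xs → Nbr a b → Edge xs a b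
  nbr⇒edge u l am bm ab = edge-toward u l am bm (λ e → nbr-irrefl ab (sym e)) ab here

  Inside : List V → V → V → V → Set
  Inside xs m p q = Σ V λ k → Σ V λ k' → k ≢ k' × Edge xs m k × Edge xs m k' × Branch m k p × Branch m k' q

  inside-swap : ∀ {xs m p q} → Inside xs m p q → Inside xs m q p
  inside-swap (k , k' , ne , e1 , e2 , c1 , c2) = k' , k , (λ e → ne (sym e)) , e2 , e1 , c2 , c1

  inside-there : ∀ {x xs m p q} → Inside xs m p q → Inside (x ∷ xs) m p q
  inside-there (k , k' , ne , e1 , e2 , c1 , c2) = k , k' , ne , edge-there e1 , edge-there e2 , c1 , c2

  inside-extend : ∀ {x y zs m q} → Nbr y x → y ≢ m → x ≢ m → Inside (y ∷ zs) m y q → Inside (x ∷ y ∷ zs) m x q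
  inside-extend r ym xm (k , k' , ne , e1 , e2 , c1 , c2) =
    k , k' , ne , edge-there e1 , edge-there e2 , reach-trans c1 (there (r , ym , xm) here) , c2

  inside-after-head : ∀ {x y ys b c} → Unique (y ∷ ys) → Linked Nbr (x ∷ y ∷ ys) → ¬ (x ∈ (y ∷ ys)) →
      b ∈ (y ∷ ys) → c ∈ (y ∷ ys) → b ≢ c → Inside (x ∷ y ∷ ys) b x c ⊎ Inside (x ∷ y ∷ ys) c x b
  inside-after-head u l nx (ahere refl) (ahere refl) ne = ⊥-elim (ne refl)
  inside-after-head {x} {y} {y2 ∷ ys} (uy ∷ u) (r ∷ l) nx (ahere refl) (athere cm) ne =
    inj₁ (x , y2 , (λ e → nx (subst (_∈ _) (sym e) (athere (ahere refl)))) , inj₂ now , inj₁ (later now) , here ,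
          reach-from-head (Linked.tail l) uy cm)
  inside-after-head {x} {y} {y2 ∷ ys} (uy ∷ u) (r ∷ l) nx (athere bm) (ahere refl) ne =
    inj₂ (x , y2 , (λ e → nx (subst (_∈ _) (sym e) (athere (ahere refl)))) , inj₂ now , inj₁ (later now) , here ,
          reach-from-head (Linked.tail l) uy bm)
  inside-after-head {x} {y} {y2 ∷ ys} {b} {c} (uy ∷ u) (r ∷ l) nx (athere bm) (athere cm) ne
    with inside-after-head u l (λ m → all≢⇒∉ uy m) bm cm ne
  ... | inj₁ md = inj₁ (inside-extend (nbr-sym r) (λ e → all≢⇒∉ uy (subst (_∈ _) (sym e) bm))
                              (λ e → nx (subst (_∈ _) (sym e) (athere bm))) md)
  ... | inj₂ md = inj₂ (inside-extend (nbr-sym r) (λ e → all≢⇒∉ uy (subst (_∈ _) (sym e) cm))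
                              (λ e → nx (subst (_∈ _) (sym e) (athere cm))) md)

  one-inside : ∀ {xs : List V} {a b c} → Unique xs → Linked Nbr xs → a ∈ xs → b ∈ xs → c ∈ xs →
       a ≢ b → a ≢ c → b ≢ c → Inside xs a b c ⊎ Inside xs b a c ⊎ Inside xs c a b
  one-inside u l (ahere refl) (ahere refl) cm ab ac bc = ⊥-elim (ab refl)
  one-inside u l (ahere refl) bm (ahere refl) ab ac bc = ⊥-elim (ac refl)
  one-inside u l am (ahere refl) (ahere refl) ab ac bc = ⊥-elim (bc refl)
  one-inside {x ∷ (y ∷ ys)} (ux ∷ u) l (ahere refl) (athere bm) (athere cm) ab ac bc with inside-after-head u l (all≢⇒∉ ux) bm cm bc
  ... | inj₁ md = inj₂ (inj₁ md)
  ... | inj₂ md = inj₂ (inj₂ md)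
  one-inside {x ∷ (y ∷ ys)} (ux ∷ u) l (athere am) (ahere refl) (athere cm) ab ac bc with inside-after-head u l (all≢⇒∉ ux) am cm ac
  ... | inj₁ md = inj₁ md
  ... | inj₂ md = inj₂ (inj₂ (inside-swap md))
  one-inside {x ∷ (y ∷ ys)} (ux ∷ u) l (athere am) (athere bm) (ahere refl) ab ac bc with inside-after-head u l (all≢⇒∉ ux) am bm ab
  ... | inj₁ md = inj₁ (inside-swap md)
  ... | inj₂ md = inj₂ (inj₁ (inside-swap md))
  one-inside (_ ∷ u) l (athere am) (athere bm) (athere cm) ab ac bc with one-inside u (Linked.tail l) am bm cm ab ac bc
  ... | inj₁ md = inj₁ (inside-there md)
  ... | inj₂ (inj₁ md) = inj₂ (inj₁ (inside-there md))
  ... | inj₂ (inj₂ md) = inj₂ (inj₂ (inside-there md))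

  head-not-inside : ∀ {x : V} {xs p q} → Unique (x ∷ xs) → Inside (x ∷ xs) x p q → ⊥
  head-not-inside u (k , k' , ne , e1 , e2 , _) with two-edges⇒inner u e1 e2 ne
  ... | _ , _ , c1 , _ = head-no-pred u c1

  last-not-inside : ∀ {x : V} {xs l p q} → Unique (x ∷ xs) → lastOf x xs ≡ l → Inside (x ∷ xs) l p q → ⊥
  last-not-inside u e (k , k' , ne , e1 , e2 , _) with two-edges⇒inner u e1 e2 ne
  ... | _ , _ , _ , c2 = last-no-succ u e c2

  OnPath : Path T → V → Set
  OnPath P m = m ∈ Path.verts P

  edge-on₁ : ∀ (P : Path T) {a b} → EdgeOf P a b → OnPath P a
  edge-on₁ P (inj₁ c) = consec-∈₁ c
  edge-on₁ P (inj₂ c) = consec-∈₂ c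

  edge-on₂ : ∀ (P : Path T) {a b} → EdgeOf P a b → OnPath P b
  edge-on₂ P (inj₁ c) = consec-∈₂ c
  edge-on₂ P (inj₂ c) = consec-∈₁ c

  edge-nbr : ∀ (P : Path T) {a b} → EdgeOf P a b → Nbr a b
  edge-nbr P e = edge⇒nbr (Path.linked P) e

  edge-sym : ∀ {P : Path T} {a b} → EdgeOf P a b → EdgeOf P b a
  edge-sym (inj₁ c) = inj₂ c
  edge-sym (inj₂ c) = inj₁ c

  path-edge-toward : ∀ (P : Path T) {w m c} → OnPath P w → OnPath P m → m ≢ w → Nbr w c → Branch w c m → EdgeOf P w c
  path-edge-toward P = edge-toward (Path.unique P) (Path.linked P)

  path-edges-toward : ∀ (P : Path T) {w a b c c'} → OnPath P a → OnPath P b → a ≢ w → b ≢ w →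
          Nbr w c → Nbr w c' → c ≢ c' → Branch w c a → Branch w c' b → EdgeOf P w c × EdgeOf P w c'
  path-edges-toward P = edges-toward (Path.unique P) (Path.linked P)

  path-nbr⇒edge : ∀ (P : Path T) {a b} → OnPath P a → OnPath P b → Nbr a b → EdgeOf P a b
  path-nbr⇒edge P = nbr⇒edge (Path.unique P) (Path.linked P)

  path-degree≤2 : ∀ (P : Path T) {w a b c} → EdgeOf P w a → EdgeOf P w b → EdgeOf P w c →
           a ≢ b → a ≢ c → b ≢ c → ⊥
  path-degree≤2 P = degree≤2 (Path.unique P)

  two-edges⇒crosses : ∀ (P : Path T) {w a b} → EdgeOf P w a → EdgeOf P w b → a ≢ b → Crosses P w
  two-edges⇒crosses P e1 e2 ne with two-edges⇒inner (Path.unique P) e1 e2 ne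
  ... | p , s , c1 , c2 = p , s , c1 , c2

  crosses⇒two-edges : ∀ (P : Path T) {w} → Crosses P w → Σ V λ a → Σ V λ b → a ≢ b × EdgeOf P w a × EdgeOf P w b
  crosses⇒two-edges P (p , s , c1 , c2) = p , s , (λ e → consec-asym (Path.unique P) c1 (subst (λ z → Consec _ _ z) (sym e) c2)) ,
                                inj₂ c1 , inj₁ c2

  crosses⇒on : ∀ {P : Path T} {w} → Crosses P w → OnPath P w
  crosses⇒on (p , s , c1 , c2) = consec-∈₂ c1

  avoiding-path-connected : ∀ (P : Path T) {w m m'} → ¬ OnPath P w → OnPath P m → OnPath P m' → Reach (NbrAvoiding w) m m'
  avoiding-path-connected P avoiding-source≢ = avoiding-list-connected avoiding-source≢ (Path.linked P)

  first-on : ∀ (P : Path T) → OnPath P (Path.first P)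
  first-on P = ahere refl

  final-on : ∀ (P : Path T) → OnPath P (Path.final P)
  final-on P = lastOf-∈ (Path.first P) (Path.rest P)

  first≢final : ∀ (P : Path T) → Path.first P ≢ Path.final P
  first≢final P e with Path.rest P | Path.oneEdge P | Path.unique P
  ... | y ∷ ys | _ | al ∷ _ = all≢⇒∉ al (subst (_∈ (y ∷ ys)) (sym e) (lastOf-∈ y ys))

  end-on : ∀ (P : Path T) {e} → e ≡ Path.first P ⊎ e ≡ Path.final P → OnPath P e
  end-on P (inj₁ q) = subst (OnPath P) (sym q) (first-on P)
  end-on P (inj₂ q) = subst (OnPath P) (sym q) (final-on P)

  inner-not-end : ∀ (P : Path T) {w a b} → EdgeOf P w a → EdgeOf P w b → a ≢ b → w ≢ Path.first P × w ≢ Path.final P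
  inner-not-end P e1 e2 ne with two-edges⇒inner (Path.unique P) e1 e2 ne
  ... | p , s , c1 , c2 = (λ q → head-no-pred (Path.unique P) (subst (λ k → Consec (Path.verts P) p k) q c1)) ,
                          (λ q → last-no-succ (Path.unique P) (sym q) c2)

  edge? : ∀ (P : Path T) a b → Dec (EdgeOf P a b)
  edge? P a b = consec? _≟F_ (Path.verts P) a b ⊎-dec consec? _≟F_ (Path.verts P) b a

  -- m separates p from q (they lie in different branches at m): m is an inner vertex of the p–q path.
  Separates : V → V → V → Set
  Separates m p q = Σ V λ k → Σ V λ k' → Nbr m k × Nbr m k' × k ≢ k' × Branch m k p × Branch m k' q

  Between : V → V → V → Set
  Between a b m = m ≡ a ⊎ m ≡ b ⊎ Separates m a b

  separates-sym : ∀ {m p q} → Separates m p q → Separates m q p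
  separates-sym (k , k' , a1 , a2 , ne , c1 , c2) = k' , k , a2 , a1 , (λ e → ne (sym e)) , c2 , c1

  between-sym : ∀ {a b m} → Between a b m → Between b a m
  between-sym (inj₁ e) = inj₂ (inj₁ e)
  between-sym (inj₂ (inj₁ e)) = inj₁ e
  between-sym (inj₂ (inj₂ s)) = inj₂ (inj₂ (separates-sym s))

  separates-≢₁ : ∀ {m p q} → Separates m p q → p ≢ m
  separates-≢₁ (k , k' , a1 , a2 , ne , c1 , c2) = branch≢centre a1 c1

  separates-≢₂ : ∀ {m p q} → Separates m p q → q ≢ m
  separates-≢₂ (k , k' , a1 , a2 , ne , c1 , c2) = branch≢centre a2 c2

  separates-≢ : ∀ {m p q} → Separates m p q → p ≢ q
  separates-≢ (k , k' , a1 , a2 , ne , c1 , c2) refl = ne (branch-unique a1 a2 c1 c2)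

  same-branch-¬separates : ∀ {m p q k} → Nbr m k → Branch m k p → Branch m k q → ¬ Separates m p q
  same-branch-¬separates ak cp cq (k1 , k2 , a1 , a2 , ne , c1 , c2) = ne (trans (branch-unique a1 ak c1 cp) (branch-unique ak a2 cq c2))

  between⇒separates : ∀ {a b m} → Between a b m → m ≢ a → m ≢ b → Separates m a b
  between⇒separates (inj₁ e) ma mb = ⊥-elim (ma e)
  between⇒separates (inj₂ (inj₁ e)) ma mb = ⊥-elim (mb e)
  between⇒separates (inj₂ (inj₂ s)) ma mb = s

  inside⇒separates : ∀ (P : Path T) {m p q} → Inside (Path.verts P) m p q → Separates m p q
  inside⇒separates P (k , k' , ne , e1 , e2 , c1 , c2) = k , k' , edge-nbr P e1 , edge-nbr P e2 , ne , c1 , c2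

  on⇒between : ∀ (K : Path T) {m} → OnPath K m → Between (Path.first K) (Path.final K) m
  on⇒between K {m} mK with m ≟F Path.first K | m ≟F Path.final K
  ... | yes e | _ = inj₁ e
  ... | no _ | yes e = inj₂ (inj₁ e)
  ... | no n1 | no n2 with one-inside (Path.unique K) (Path.linked K) (first-on K) mK (final-on K)
                            (λ e → n1 (sym e)) (first≢final K) n2
  ...   | inj₁ md = ⊥-elim (head-not-inside (Path.unique K) md)
  ...   | inj₂ (inj₁ md) = inj₂ (inj₂ (inside⇒separates K md))
  ...   | inj₂ (inj₂ md) = ⊥-elim (last-not-inside (Path.unique K) refl md)

  between⇒on : ∀ (K : Path T) {m} → Between (Path.first K) (Path.final K) m → OnPath K m
  between⇒on K (inj₁ refl) = first-on K
  between⇒on K (inj₂ (inj₁ refl)) = final-on K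
  between⇒on K (inj₂ (inj₂ s@(k , k' , a1 , a2 , ne , c1 , c2))) =
    edge-on₁ K (proj₁ (path-edges-toward K (first-on K) (final-on K) (separates-≢₁ s) (separates-≢₂ s) a1 a2 ne c1 c2))

  path⇒between : ∀ (K : Path T) {a b m} → Path.first K ≡ a → Path.final K ≡ b → OnPath K m → Between a b m
  path⇒between K refl refl mK = on⇒between K mK

  between⇒path : ∀ (K : Path T) {a b m} → Path.first K ≡ a → Path.final K ≡ b → Between a b m → OnPath K m
  between⇒path K refl refl bt = between⇒on K bt

  inner-separates-ends : ∀ (P : Path T) {w a b} → EdgeOf P w a → EdgeOf P w b → a ≢ b → Separates w (Path.first P) (Path.final P)
  inner-separates-ends P {w} e1 e2 ne with inner-not-end P e1 e2 ne
  ... | nf , nl with one-inside (Path.unique P) (Path.linked P) (first-on P) (edge-on₁ P e1) (final-on P) (λ q → nf (sym q)) (first≢final P) nl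
  ...   | inj₁ md = ⊥-elim (head-not-inside (Path.unique P) md)
  ...   | inj₂ (inj₁ md) = inside⇒separates P md
  ...   | inj₂ (inj₂ md) = ⊥-elim (last-not-inside (Path.unique P) refl md)

  end-away : ∀ {w f l k t} → Separates w f l → Nbr w k → Branch w k t → Σ V λ e → (e ≡ f ⊎ e ≡ l) × Separates w e t
  end-away {k = k} (k1 , k2 , a1 , a2 , ne , c1 , c2) ak ck with k1 ≟F k
  ... | no n1 = _ , inj₁ refl , (k1 , k , a1 , ak , n1 , c1 , ck)
  ... | yes refl = _ , inj₂ refl , (k2 , k1 , a2 , a1 , (λ q → ne (sym q)) , c2 , ck)

  end-toward : ∀ {w f l k} → Separates w f l → ∀ {k'} → Nbr w k → Nbr w k' → k ≢ k' →
                (∀ {c} → Nbr w c → Branch w c f → c ≡ k ⊎ c ≡ k') → (∀ {c} → Nbr w c → Branch w c l → c ≡ k ⊎ c ≡ k') →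
                Σ V λ e → (e ≡ f ⊎ e ≡ l) × Branch w k e
  end-toward (k1 , k2 , a1 , a2 , ne , c1 , c2) ak ak' kk' d1 d2 with d1 a1 c1 | d2 a2 c2
  ... | inj₁ refl | _ = _ , inj₁ refl , c1
  ... | inj₂ _ | inj₁ refl = _ , inj₂ refl , c2
  ... | inj₂ refl | inj₂ refl = ⊥-elim (ne refl)

  path-between : ∀ {a b} → a ≢ b → Σ (Path T) λ P → Path.first P ≡ a × Path.final P ≡ b
  path-between {a} {b} ne with reach⇒simpleWalk _≟F_ {R = Nbr} (Tree.connected T a b)
  ... | [] , u , l , e = ⊥-elim (ne e)
  ... | (h ∷ t) , u , l , e =
    record { first = a ; rest = h ∷ t ; oneEdge = s≤s z≤n ; unique = u ; linked = l } , refl , e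

  -- For b off K: the vertex m' where the path from b meets K, and its first edge m'–c' off K.
  Projection : Path T → V → Set
  Projection K b = Σ V λ m' → Σ V λ c' → OnPath K m' × Nbr m' c' × ¬ EdgeOf K m' c' × Branch m' c' b ×
             (∀ k → OnPath K k → k ≢ m' → Reach (NbrAvoiding k) m' b)

  projection-along : ∀ (K : Path T) {b t} → Reach Nbr b t → OnPath K t → OnPath K b ⊎ Projection K b
  projection-along K {b} here tK = inj₁ tK
  projection-along K {b} (there {y = b1} r p) tK with b ∈? Path.verts K
  ... | yes bK = inj₁ bK
  ... | no nb with b1 ∈? Path.verts K
  ...   | yes b1K = inj₂ (b1 , b , b1K , nbr-sym r , (λ e → nb (edge-on₂ K e)) , here ,
                          λ k kK kne → there (nbr-sym r , kne' k kK kne , (λ e → nb (subst (OnPath K) (sym e) kK))) here)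
    where
    kne' : ∀ k → OnPath K k → k ≢ b1 → b1 ≢ k
    kne' k _ ne e = ne (sym e)
  ...   | no nb1 with projection-along K p tK
  ...     | inj₁ x = ⊥-elim (nb1 x)
  ...     | inj₂ (m' , c' , mK , ac , ne , cp , av) =
            inj₂ (m' , c' , mK , ac , ne ,
                  reach-trans cp (there (nbr-sym r , (λ e → nb1 (subst (OnPath K) (sym e) mK)) ,
                                             (λ e → nb (subst (OnPath K) (sym e) mK))) here) ,
                  λ k kK kne → reach-trans (av k kK kne)
                     (there (nbr-sym r , (λ e → nb1 (subst (OnPath K) (sym e) kK)) ,
                                      (λ e → nb (subst (OnPath K) (sym e) kK))) here))

  on-or-projection : ∀ (K : Path T) b → OnPath K b ⊎ Projection K b
  on-or-projection K b = projection-along K (Tree.connected T b (Path.first K)) (first-on K)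

  on-path-unless-hanging : ∀ (K : Path T) {t} →
                           (∀ {m' c'} → OnPath K m' → Nbr m' c' → ¬ EdgeOf K m' c' → Branch m' c' t → ⊥) → OnPath K t
  on-path-unless-hanging K {t} hanging⇒⊥ with on-or-projection K t
  ... | inj₁ tK = tK
  ... | inj₂ (m' , c' , mK , ac' , nE , cc' , _) = ⊥-elim (hanging⇒⊥ mK ac' nE cc')

  off-edge-toward⇒⊥ : ∀ {P : Path T} {m' c' a k b} → ¬ EdgeOf P m' c' → Nbr m' c' → Branch m' c' b → m' ≡ a →
           Nbr a k → Branch a k b → EdgeOf P a k → ⊥
  off-edge-toward⇒⊥ {P} nE ac' cc' refl ak ck ek = nE (subst (EdgeOf P _) (sym (branch-unique ac' ak cc' ck)) ek)

  intersect-sym : ∀ {P Q : Path T} → Intersect P Q → Intersect Q P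
  intersect-sym (x , y , e1 , e2) = x , y , e2 , e1

  edge∪-swap : ∀ {P Q : Path T} {w k} → EdgeOf∪ P Q w k → EdgeOf∪ Q P w k
  edge∪-swap (inj₁ e) = inj₂ e
  edge∪-swap (inj₂ e) = inj₁ e

  split-sym : ∀ {P Q : Path T} {w} → Split P Q w → Split Q P w
  split-sym {P} {Q} (a , b , c , ab , ac , bc , e1 , e2 , e3) = a , b , c , ab , ac , bc , edge∪-swap {P} {Q} e1 , edge∪-swap {P} {Q} e2 , edge∪-swap {P} {Q} e3

  split? : ∀ (P Q : Path T) w → Dec (Split P Q w)
  split? P Q w = any? λ a → any? λ b → any? λ c →
    ¬? (a ≟F b) ×-dec ¬? (a ≟F c) ×-dec ¬? (b ≟F c) ×-dec
    (edge? P w a ⊎-dec edge? Q w a) ×-dec (edge? P w b ⊎-dec edge? Q w b) ×-dec (edge? P w c ⊎-dec edge? Q w c)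

  split-of-¬∼ : ∀ {P Q : Path T} → Intersect P Q → ¬ (P ∼ Q) → Σ V (Split P Q)
  split-of-¬∼ {P} {Q} i n with any? (split? P Q)
  ... | yes s = s
  ... | no ns = ⊥-elim (n (i , λ w s → ns (w , s)))

  split-map : ∀ {P Q P' Q' : Path T} {w} → (∀ {t} → EdgeOf∪ P Q w t → EdgeOf∪ P' Q' w t) → Split P Q w → Split P' Q' w
  split-map f (a , b , c , ab , ac , bc , ea , eb , ec) = a , b , c , ab , ac , bc , f ea , f eb , f ec

  pigeonhole : ∀ {x y a b c : V} → a ≢ b → a ≢ c → b ≢ c → a ≡ x ⊎ a ≡ y → b ≡ x ⊎ b ≡ y → c ≡ x ⊎ c ≡ y → ⊥
  pigeonhole ab ac bc (inj₁ p) (inj₁ q) _ = ab (trans p (sym q))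
  pigeonhole ab ac bc (inj₂ p) (inj₂ q) _ = ab (trans p (sym q))
  pigeonhole ab ac bc (inj₁ p) (inj₂ q) (inj₁ r) = ac (trans p (sym r))
  pigeonhole ab ac bc (inj₁ p) (inj₂ q) (inj₂ r) = bc (trans q (sym r))
  pigeonhole ab ac bc (inj₂ p) (inj₁ q) (inj₁ r) = bc (trans q (sym r))
  pigeonhole ab ac bc (inj₂ p) (inj₁ q) (inj₂ r) = ac (trans p (sym r))

  ≡-or-≢ : ∀ (c x y : V) → (c ≡ x ⊎ c ≡ y) ⊎ (c ≢ x × c ≢ y)
  ≡-or-≢ c x y with c ≟F x | c ≟F y
  ... | yes p | _ = inj₁ (inj₁ p)
  ... | no _ | yes p = inj₁ (inj₂ p)
  ... | no cx | no cy = inj₂ (cx , cy)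

  split-other-neighbour : ∀ {P Q : Path T} {w} → Split P Q w → ∀ x y → Σ V λ t → EdgeOf∪ P Q w t × t ≢ x × t ≢ y
  split-other-neighbour (a , b , c , ab , ac , bc , ea , eb , ec) x y with ≡-or-≢ a x y | ≡-or-≢ b x y | ≡-or-≢ c x y
  ... | inj₂ (ax , ay) | _ | _ = a , ea , ax , ay
  ... | inj₁ _ | inj₂ (bx , by) | _ = b , eb , bx , by
  ... | inj₁ _ | inj₁ _ | inj₂ (cx , cy) = c , ec , cx , cy
  ... | inj₁ a∈ | inj₁ b∈ | inj₁ c∈ = ⊥-elim (pigeonhole ab ac bc a∈ b∈ c∈)

  common-vertex-≢ : ∀ {P Q : Path T} → Intersect P Q → ∀ w → Σ V λ e → OnPath P e × OnPath Q e × e ≢ w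
  common-vertex-≢ {P} {Q} (x , y , e1 , e2) w with x ≟F w
  ... | no ne = x , edge-on₁ P e1 , edge-on₁ Q e2 , ne
  ... | yes refl = y , edge-on₂ P e1 , edge-on₂ Q e2 , (λ e → nbr-irrefl (edge-nbr P e1) (sym e))

  split-on : ∀ {P Q : Path T} {w} → Split P Q w → OnPath P w
  split-on {P} {Q} {w} (a , b , c , ab , ac , bc , ea , eb , ec) with w ∈? Path.verts P
  ... | yes p = p
  ... | no np = ⊥-elim (path-degree≤2 Q (o ea) (o eb) (o ec) ab ac bc)
    where
    o : ∀ {k} → EdgeOf∪ P Q w k → EdgeOf Q w k
    o (inj₁ e) = ⊥-elim (np (edge-on₁ P e))
    o (inj₂ e) = e

  common-direction : ∀ {P Q : Path T} {w} → OnPath P w → OnPath Q w → Intersect P Q → Σ V λ y → EdgeOf P w y × EdgeOf Q w y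
  common-direction {P} {Q} {w} wP wQ (e1 , e2 , f0 , f2) with e1 ≟F w
  ... | yes refl = e2 , f0 , f2
  ... | no ne with branch-exists ne
  ...   | d , ad , cd = d , path-edge-toward P wP (edge-on₁ P f0) ne ad cd , path-edge-toward Q wQ (edge-on₁ Q f2) ne ad cd

  Fork : Path T → Path T → V → V → Set
  Fork P Q w y = Σ V λ x → Σ V λ z → x ≢ y × z ≢ y × x ≢ z × EdgeOf P w x × EdgeOf Q w z

  fork-of : ∀ {P Q : Path T} {w y α β} → EdgeOf P w y → EdgeOf Q w y → α ≢ β → α ≢ y → β ≢ y →
          EdgeOf∪ P Q w α → EdgeOf∪ P Q w β → Fork P Q w y
  fork-of {P} ey _ ne ay by (inj₁ ea) (inj₁ eb) = ⊥-elim (path-degree≤2 P ey ea eb (λ e → ay (sym e)) (λ e → by (sym e)) ne)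
  fork-of {Q = Q} _ ey ne ay by (inj₂ ea) (inj₂ eb) = ⊥-elim (path-degree≤2 Q ey ea eb (λ e → ay (sym e)) (λ e → by (sym e)) ne)
  fork-of _ _ ne ay by (inj₁ ea) (inj₂ eb) = _ , _ , ay , by , ne , ea , eb
  fork-of _ _ ne ay by (inj₂ ea) (inj₁ eb) = _ , _ , by , ay , (λ e → ne (sym e)) , eb , ea

  split⇒fork : ∀ {P Q : Path T} {w y} → EdgeOf P w y → EdgeOf Q w y → Split P Q w → Fork P Q w y
  split⇒fork {P} {Q} {y = y} ep eq (a , b , c , ab , ac , bc , ea , eb , ec) with a ≟F y
  ... | yes refl = fork-of {P} {Q} ep eq bc (λ e → ab (sym e)) (λ e → ac (sym e)) eb ec
  ... | no ay with b ≟F y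
  ...   | yes refl = fork-of {P} {Q} ep eq ac ay (λ e → bc (sym e)) ea ec
  ...   | no by = fork-of {P} {Q} ep eq ab ay by ea eb

  record K₄P₄Rep (P0 P1 P2 P3 : Path T) : Set where
    field
      i01 : Intersect P0 P1
      i02 : Intersect P0 P2
      i03 : Intersect P0 P3
      i12 : Intersect P1 P2
      i13 : Intersect P1 P3
      i23 : Intersect P2 P3
      n01 : ∀ w → ¬ Split P0 P1 w
      n12 : ∀ w → ¬ Split P1 P2 w
      n23 : ∀ w → ¬ Split P2 P3 w

  reverse : ∀ {P0 P1 P2 P3} → K₄P₄Rep P0 P1 P2 P3 → K₄P₄Rep P3 P2 P1 P0
  reverse {P0} {P1} {P2} {P3} h = record
    { i01 = intersect-sym {P2} {P3} (K₄P₄Rep.i23 h) ; i02 = intersect-sym {P1} {P3} (K₄P₄Rep.i13 h) ; i03 = intersect-sym {P0} {P3} (K₄P₄Rep.i03 h)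
    ; i12 = intersect-sym {P1} {P2} (K₄P₄Rep.i12 h) ; i13 = intersect-sym {P0} {P2} (K₄P₄Rep.i02 h) ; i23 = intersect-sym {P0} {P1} (K₄P₄Rep.i01 h)
    ; n01 = λ w s → K₄P₄Rep.n23 h w (split-sym {P3} {P2} s) ; n12 = λ w s → K₄P₄Rep.n12 h w (split-sym {P2} {P1} s)
    ; n23 = λ w s → K₄P₄Rep.n01 h w (split-sym {P1} {P0} s) }

  SharedEdge : Path T → Path T → Path T → Path T → Set
  SharedEdge P0 P1 P2 P3 = Σ V λ a → Σ V λ b → EdgeOf P0 a b × EdgeOf P1 a b × EdgeOf P2 a b × EdgeOf P3 a b

  -- Around a split vertex u of P₀, P₂ the paths form a star with three rays x, y, z: P₀ uses x, y and
  -- P₂ uses y, z; P₁ can only use y and P₃ only y or z, since any other ray would split P₁ from P₀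
  -- or P₂, or P₃ from P₂.
  record SplitStar (P0 P1 P2 P3 : Path T) (u : V) : Set where
    field
      x y z : V
      ax : Nbr u x
      ay : Nbr u y
      az : Nbr u z
      xy : x ≢ y
      yz : y ≢ z
      xz : x ≢ z
      e0x : EdgeOf P0 u x
      e0y : EdgeOf P0 u y
      e2y : EdgeOf P2 u y
      e2z : EdgeOf P2 u z
      nbr₀ : ∀ {c} → EdgeOf P0 u c → c ≡ x ⊎ c ≡ y
      nbr₁ : ∀ {c} → EdgeOf P1 u c → c ≡ y
      nbr₂ : ∀ {c} → EdgeOf P2 u c → c ≡ y ⊎ c ≡ z
      nbr₃ : ∀ {c} → EdgeOf P3 u c → c ≡ y ⊎ c ≡ z
      side₀ : ∀ {m} → OnPath P0 m → m ≢ u → Branch u x m ⊎ Branch u y m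
      side₁ : ∀ {m} → OnPath P1 m → m ≢ u → Branch u y m
      side₂ : ∀ {m} → OnPath P2 m → m ≢ u → Branch u y m ⊎ Branch u z m
      side₃ : ∀ {m} → OnPath P3 m → m ≢ u → Branch u y m ⊎ Branch u z m

  common-option : ∀ {d x y z : V} → d ≡ x ⊎ d ≡ y → d ≡ y ⊎ d ≡ z → x ≢ z → d ≡ y
  common-option (inj₂ p) _ _ = p
  common-option (inj₁ _) (inj₁ p) _ = p
  common-option (inj₁ p) (inj₂ q) xz = ⊥-elim (xz (trans (sym p) q))

  path-branch-at : ∀ (P : Path T) {u m} → OnPath P u → OnPath P m → m ≢ u →
                   ∀ {x y} → (∀ {c} → EdgeOf P u c → c ≡ x ⊎ c ≡ y) → Branch u x m ⊎ Branch u y m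
  path-branch-at P uP mP mu only with branch-exists mu
  ... | d , ad , cd with only (path-edge-toward P uP mP mu ad cd)
  ...   | inj₁ refl = inj₁ cd
  ...   | inj₂ refl = inj₂ cd

  -- m and e lie in one branch at u since P avoids u, so Q leaves u toward e along the ray d.
  avoiding-path-branch : ∀ (P Q : Path T) {u m e d} → ¬ OnPath P u → OnPath P m → OnPath P e → OnPath Q e →
                         OnPath Q u → e ≢ u → Nbr u d → Branch u d m → EdgeOf Q u d
  avoiding-path-branch P Q nu mP eP eQ uQ eu ad cd =
    path-edge-toward Q uQ eQ eu ad (reach-trans cd (avoiding-path-connected P nu mP eP))

  module StarAt {P0 P1 P2 P3 : Path T} (h : K₄P₄Rep P0 P1 P2 P3) {u : V} (su : Split P0 P2 u)
                {x y z : V} (xy : x ≢ y) (zy : z ≢ y) (xz : x ≢ z)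
                (e0x : EdgeOf P0 u x) (e0y : EdgeOf P0 u y) (e2y : EdgeOf P2 u y) (e2z : EdgeOf P2 u z) where
    open K₄P₄Rep h

    u∈P₀ : OnPath P0 u
    u∈P₀ = split-on {P0} {P2} su
    u∈P₂ : OnPath P2 u
    u∈P₂ = split-on {P2} {P0} (split-sym {P0} {P2} su)

    yz : y ≢ z
    yz e = zy (sym e)

    nbr₀ : ∀ {c} → EdgeOf P0 u c → c ≡ x ⊎ c ≡ y
    nbr₀ {c} e with ≡-or-≢ c x y
    ... | inj₁ p = p
    ... | inj₂ (cx , cy) = ⊥-elim (path-degree≤2 P0 e0x e0y e xy (λ q → cx (sym q)) (λ q → cy (sym q)))

    nbr₂ : ∀ {c} → EdgeOf P2 u c → c ≡ y ⊎ c ≡ z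
    nbr₂ {c} e with ≡-or-≢ c y z
    ... | inj₁ p = p
    ... | inj₂ (cy , cz) = ⊥-elim (path-degree≤2 P2 e2y e2z e yz (λ q → cy (sym q)) (λ q → cz (sym q)))

    nbr₁ : ∀ {c} → EdgeOf P1 u c → c ≡ y
    nbr₁ {c} e with ≡-or-≢ c y x
    ... | inj₁ (inj₁ p) = p
    ... | inj₁ (inj₂ refl) = ⊥-elim (n12 u (x , y , z , xy , xz , yz , inj₁ e , inj₂ e2y , inj₂ e2z))
    ... | inj₂ (cy , cx) = ⊥-elim (n01 u (x , y , c , xy , (λ q → cx (sym q)) , (λ q → cy (sym q)) ,
                                                 inj₁ e0x , inj₁ e0y , inj₂ e))

    nbr₃ : ∀ {c} → EdgeOf P3 u c → c ≡ y ⊎ c ≡ z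
    nbr₃ {c} e with ≡-or-≢ c y z
    ... | inj₁ p = p
    ... | inj₂ (cy , cz) = ⊥-elim (n23 u (y , z , c , yz , (λ q → cy (sym q)) , (λ q → cz (sym q)) ,
                                                 inj₁ e2y , inj₁ e2z , inj₂ e))

    side₁ : ∀ {m} → OnPath P1 m → m ≢ u → Branch u y m
    side₁ {m} mP mu with branch-exists mu
    ... | d , ad , cd with u ∈? Path.verts P1
    ...   | yes u∈P₁ = subst (λ k → Branch u k m) (nbr₁ (path-edge-toward P1 u∈P₁ mP mu ad cd)) cd
    ...   | no nu with common-vertex-≢ {P0} {P1} i01 u | common-vertex-≢ {P1} {P2} i12 u
    ...     | e , eP₀ , eP₁ , eu | e' , e'P₁ , e'P₂ , e'u =
      subst (λ k → Branch u k m)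
            (common-option (nbr₀ (avoiding-path-branch P1 P0 nu mP eP₁ eP₀ u∈P₀ eu ad cd))
                           (nbr₂ (avoiding-path-branch P1 P2 nu mP e'P₁ e'P₂ u∈P₂ e'u ad cd)) xz)
            cd

    side₃ : ∀ {m} → OnPath P3 m → m ≢ u → Branch u y m ⊎ Branch u z m
    side₃ {m} mP mu with u ∈? Path.verts P3
    ... | yes u∈P₃ = path-branch-at P3 u∈P₃ mP mu nbr₃
    ... | no nu with branch-exists mu | common-vertex-≢ {P2} {P3} i23 u
    ...   | d , ad , cd | e , eP₂ , eP₃ , eu
      with nbr₂ (avoiding-path-branch P3 P2 nu mP eP₃ eP₂ u∈P₂ eu ad cd)
    ...     | inj₁ refl = inj₁ cd
    ...     | inj₂ refl = inj₂ cd

    star : SplitStar P0 P1 P2 P3 u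
    star = record
      { x = x ; y = y ; z = z ; ax = edge-nbr P0 e0x ; ay = edge-nbr P0 e0y ; az = edge-nbr P2 e2z
      ; xy = xy ; yz = yz ; xz = xz ; e0x = e0x ; e0y = e0y ; e2y = e2y ; e2z = e2z
      ; nbr₀ = nbr₀ ; nbr₁ = nbr₁ ; nbr₂ = nbr₂ ; nbr₃ = nbr₃
      ; side₀ = λ mP mu → path-branch-at P0 u∈P₀ mP mu nbr₀ ; side₁ = side₁
      ; side₂ = λ mP mu → path-branch-at P2 u∈P₂ mP mu nbr₂ ; side₃ = side₃ }

  split-star : ∀ {P0 P1 P2 P3 : Path T} {u} → K₄P₄Rep P0 P1 P2 P3 → Split P0 P2 u → SplitStar P0 P1 P2 P3 u
  split-star {P0} {P1} {P2} h su
    with common-direction {P0} {P2} (split-on {P0} {P2} su) (split-on {P2} {P0} (split-sym {P0} {P2} su))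
                          (K₄P₄Rep.i02 h)
  ... | y , e0y , e2y with split⇒fork {P0} {P2} e0y e2y su
  ...   | x , z , xy , zy , xz , e0x , e2z = StarAt.star h su xy zy xz e0x e0y e2y e2z

  star-y-unique : ∀ {P0 P1 P2 P3 u} (H1 H2 : SplitStar P0 P1 P2 P3 u) → SplitStar.y H2 ≡ SplitStar.y H1
  star-y-unique H1 H2 with SplitStar.nbr₀ H1 (SplitStar.e0y H2)
  ... | inj₂ e = e
  ... | inj₁ e with SplitStar.nbr₂ H1 (SplitStar.e2y H2)
  ...   | inj₁ e' = ⊥-elim (SplitStar.xy H1 (trans (sym e) e'))
  ...   | inj₂ e' = ⊥-elim (SplitStar.xz H1 (trans (sym e) e'))

  star-z-unique : ∀ {P0 P1 P2 P3 u} (H1 H2 : SplitStar P0 P1 P2 P3 u) → SplitStar.z H2 ≡ SplitStar.z H1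
  star-z-unique H1 H2 with SplitStar.nbr₂ H1 (SplitStar.e2z H2)
  ... | inj₂ e = e
  ... | inj₁ e = ⊥-elim (SplitStar.yz H2 (trans (star-y-unique H1 H2) (sym e)))

  module Core {P0 P1 P2 P3 : Path T} (h : K₄P₄Rep P0 P1 P2 P3) {u : V} (su : Split P0 P2 u)
             {v : V} (sv : Split P1 P3 v) where
    H : SplitStar P0 P1 P2 P3 u
    H = split-star h su
    -- The star at v is taken in the reversed family (P₃, P₂, P₁, P₀), where P₁ plays the role of P₂:
    -- H'.e2y, H'.e2z are edges of P₁, and H'.nbr₁ says that P₂ uses only the ray H'.y at v.
    H' : SplitStar P3 P2 P1 P0 v
    H' = split-star (reverse h) (split-sym {P1} {P3} sv)
    module H = SplitStar H
    module H' = SplitStar H'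

    u≢v : u ≢ v
    u≢v e = H.yz (trans (H'.nbr₁ (subst (λ k → EdgeOf P2 k H.y) e H.e2y))
                       (sym (H'.nbr₁ (subst (λ k → EdgeOf P2 k H.z) e H.e2z))))
    v≢u : v ≢ u
    v≢u e = u≢v (sym e)

    v∈P₁ : OnPath P1 v
    v∈P₁ = edge-on₁ P1 H'.e2y
    u∈P₂ : OnPath P2 u
    u∈P₂ = edge-on₁ P2 H.e2y
    u∈P₀ : OnPath P0 u
    u∈P₀ = edge-on₁ P0 H.e0y
    v∈P₃ : OnPath P3 v
    v∈P₃ = edge-on₁ P3 H'.e0y

    v∈Bu : Branch u H.y v
    v∈Bu = H.side₁ v∈P₁ v≢u
    u∈Bv : Branch v H'.y u
    u∈Bv = H'.side₁ u∈P₂ u≢v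

    core-path : Σ (Path T) λ P → Path.first P ≡ u × Path.final P ≡ v
    core-path = path-between u≢v
    core : Path T
    core = proj₁ core-path
    core-first : Path.first core ≡ u
    core-first = proj₁ (proj₂ core-path)
    core-final : Path.final core ≡ v
    core-final = proj₂ (proj₂ core-path)
    core⇒between : ∀ {m} → OnPath core m → Between u v m
    core⇒between = path⇒between core core-first core-final
    between⇒core : ∀ {m} → Between u v m → OnPath core m
    between⇒core = between⇒path core core-first core-final
    u∈core : OnPath core u
    u∈core = between⇒core (inj₁ refl)
    v∈core : OnPath core v
    v∈core = between⇒core (inj₂ (inj₁ refl))
    core-u-edge : EdgeOf core u H.y
    core-u-edge = path-edge-toward core u∈core v∈core v≢u H.ay v∈Bu
    core-v-edge : EdgeOf core v H'.y
    core-v-edge = path-edge-toward core v∈core u∈core u≢v H'.ay u∈Bv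

    common₁₂ : ∀ m → Σ V λ e → OnPath P1 e × OnPath P2 e × e ≢ m
    common₁₂ m = common-vertex-≢ {P1} {P2} (K₄P₄Rep.i12 h) m

    -- A common vertex e of P₁, P₂ lies in some branch g at m: if g holds v then P₂ runs from u through m
    -- to e, otherwise P₁ runs from v through m to e.
    core-inner-edges : ∀ {m ku kv} → Nbr m ku → Nbr m kv → ku ≢ kv → Branch m ku u → Branch m kv v →
           (Σ V λ g → g ≢ kv × EdgeOf P1 m kv × EdgeOf P1 m g) ⊎ (EdgeOf P2 m ku × EdgeOf P2 m kv)
    core-inner-edges {m} {ku} {kv} aku akv ne cu cv with common₁₂ m
    ... | e , eP1 , eP2 , em with branch-exists em
    ...   | g , ag , cg with g ≟F kv
    ...     | yes refl = inj₂ (path-edges-toward P2 u∈P₂ eP2 (branch≢centre aku cu) em aku ag ne cu cg)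
    ...     | no gk = inj₁ (g , gk , path-edges-toward P1 v∈P₁ eP1 (branch≢centre akv cv) em akv ag (λ e → gk (sym e)) cv cg)

    -- A second split vertex w of P₀, P₂ is impossible: v lies in the y-branches at u and at w, so it
    -- either lies inside the u–w segment of P₀, where P₂ would use two rays at v, or hangs off that
    -- segment at a vertex where P₁ and P₂ split.
    module SecondSplit₀₂ {w : V} (sw : Split P0 P2 w) (w≢u : w ≢ u) where
      Hw : SplitStar P0 P1 P2 P3 w
      Hw = split-star h sw
      module Hw = SplitStar Hw
      w∈P₀ : OnPath P0 w
      w∈P₀ = split-on {P0} {P2} sw
      w∈P₂ : OnPath P2 w
      w∈P₂ = split-on {P2} {P0} (split-sym {P0} {P2} sw)
      u≢w : u ≢ w
      u≢w e = w≢u (sym e)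
      w∈Bu : Branch u H.y w
      w∈Bu = branch-common (H.side₀ w∈P₀ w≢u) (H.side₂ w∈P₂ w≢u) H.ax H.az H.xz
      u∈Bw : Branch w Hw.y u
      u∈Bw = branch-common (Hw.side₀ u∈P₀ u≢w) (Hw.side₂ u∈P₂ u≢w) Hw.ax Hw.az Hw.xz
      v≢w : v ≢ w
      v≢w e = Hw.yz (trans (H'.nbr₁ (subst (λ k → EdgeOf P2 k Hw.y) (sym e) Hw.e2y))
                           (sym (H'.nbr₁ (subst (λ k → EdgeOf P2 k Hw.z) (sym e) Hw.e2z))))
      v∈Bw : Branch w Hw.y v
      v∈Bw = Hw.side₁ v∈P₁ v≢w

      separates-u-w : ∀ {m} → OnPath P0 m → m ≢ u → m ≢ w → Branch u H.y m → Branch w Hw.y m → Separates m u w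
      separates-u-w {m} mP mu mw c1 c2 =
        inner (one-inside (Path.unique P0) (Path.linked P0) u∈P₀ w∈P₀ mP u≢w (λ e → mu (sym e)) (λ e → mw (sym e)))
        where
        inner : Inside (Path.verts P0) u w m ⊎ Inside (Path.verts P0) w u m ⊎ Inside (Path.verts P0) m u w →
                Separates m u w
        inner (inj₁ md) = ⊥-elim (same-branch-¬separates H.ay w∈Bu c1 (inside⇒separates P0 md))
        inner (inj₂ (inj₁ md)) = ⊥-elim (same-branch-¬separates Hw.ay u∈Bw c2 (inside⇒separates P0 md))
        inner (inj₂ (inj₂ md)) = inside⇒separates P0 md

      P₂-two-rays-at-v : Separates v u w → ⊥
      P₂-two-rays-at-v (k , k' , a1 , a2 , ne , c1 , c2) =
        ne (trans (H'.nbr₁ (proj₁ E)) (sym (H'.nbr₁ (proj₂ E))))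
        where
        E : EdgeOf P2 v k × EdgeOf P2 v k'
        E = path-edges-toward P2 u∈P₂ w∈P₂ u≢v (λ e → v≢w (sym e)) a1 a2 ne c1 c2

      P₁-P₂-split-at : ∀ {m c} → OnPath P0 m → Nbr m c → ¬ EdgeOf P0 m c → Branch m c v → Separates m u w → ⊥
      P₁-P₂-split-at {m} {c} mP ac nE cc (ku , kw , aku , akw , ne , c1 , c2) = toward-P₁ (common-vertex-≢ {P0} {P1} (K₄P₄Rep.i01 h) m)
        where
        mu : u ≢ m
        mu = branch≢centre aku c1
        mw : w ≢ m
        mw = branch≢centre akw c2
        E2 : EdgeOf P2 m ku × EdgeOf P2 m kw
        E2 = path-edges-toward P2 u∈P₂ w∈P₂ mu mw aku akw ne c1 c2
        c≢ku : c ≢ ku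
        c≢ku e = nE (subst (EdgeOf P0 m) (sym e) (path-edge-toward P0 mP u∈P₀ mu aku c1))
        c≢kw : c ≢ kw
        c≢kw e = nE (subst (EdgeOf P0 m) (sym e) (path-edge-toward P0 mP w∈P₀ mw akw c2))
        toward-P₁ : (Σ V λ e → OnPath P0 e × OnPath P1 e × e ≢ m) → ⊥
        toward-P₁ (e , eP0 , eP1 , em) = toward-e (branch-exists em)
          where
          toward-e : (Σ V λ g → Nbr m g × Branch m g e) → ⊥
          toward-e (g , ag , cg) = K₄P₄Rep.n12 h m (c , ku , kw , c≢ku , c≢kw , ne , inj₁ E1c , inj₂ (proj₁ E2) , inj₂ (proj₂ E2))
            where
            c≢g : c ≢ g
            c≢g e = nE (subst (EdgeOf P0 m) (sym e) (path-edge-toward P0 mP eP0 em ag cg))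
            E1c : EdgeOf P1 m c
            E1c = proj₁ (path-edges-toward P1 v∈P₁ eP1 (branch≢centre ac cc) em ac ag c≢g cc cg)

      hanging : Projection P0 v → ⊥
      hanging (m , c , mP , ac , nE , cc , avoid) = cases (m ≟F u) (m ≟F w)
        where
        cases : Dec (m ≡ u) → Dec (m ≡ w) → ⊥
        cases (yes e) _ = off-edge-toward⇒⊥ {P0} nE ac cc e H.ay v∈Bu H.e0y
        cases (no _) (yes e) = off-edge-toward⇒⊥ {P0} nE ac cc e Hw.ay v∈Bw Hw.e0y
        cases (no mu) (no mw) = P₁-P₂-split-at mP ac nE cc (separates-u-w mP mu mw
          (reach-trans v∈Bu (reach-sym nbrAvoiding-sym (avoid u u∈P₀ (λ e → mu (sym e)))))
          (reach-trans v∈Bw (reach-sym nbrAvoiding-sym (avoid w w∈P₀ (λ e → mw (sym e))))))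

      contradiction : ⊥
      contradiction with on-or-projection P0 v
      ... | inj₁ vP0 = P₂-two-rays-at-v (separates-u-w vP0 v≢u v≢w v∈Bu v∈Bw)
      ... | inj₂ p = hanging p

    split₀₂-unique : ∀ {w} → Split P0 P2 w → w ≡ u
    split₀₂-unique {w} sw with w ≟F u
    ... | yes e = e
    ... | no wu = ⊥-elim (SecondSplit₀₂.contradiction sw wu)

    off-core-≢ : ∀ {m' c' k} → ¬ EdgeOf core m' c' → OnPath core m' → ∀ {t} → OnPath core t → t ≢ m' → Nbr m' k → Branch m' k t → c' ≢ k
    off-core-≢ nE mK tK tm ak ck e = nE (subst (EdgeOf core _) (sym e) (path-edge-toward core mK tK tm ak ck))

    on-core-unless-hanging : ∀ {t} → (∀ {m' c'} → Between u v m' → Nbr m' c' → ¬ EdgeOf core m' c' → Branch m' c' t → ⊥) →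
                             Between u v t
    on-core-unless-hanging hanging⇒⊥ = core⇒between (on-path-unless-hanging core (λ mK → hanging⇒⊥ (core⇒between mK)))

    P₁-hanging-with-edges⇒⊥ : ∀ {m' c' ku kv} → OnPath core m' → Nbr m' c' → ¬ EdgeOf core m' c' →
           Nbr m' ku → Nbr m' kv → ku ≢ kv → Branch m' ku u → Branch m' kv v →
           EdgeOf P1 m' c' → EdgeOf P1 m' kv → (Σ V λ e → OnPath P1 e × OnPath P2 e × e ≢ m') → ⊥
    P₁-hanging-with-edges⇒⊥ {m'} {c'} {ku} {kv} mK ac' nE aku akv ne cu cv E1c E1kv (e , eP1 , eP2 , em) =
      toward-e (branch-exists em)
      where
      c'kv : c' ≢ kv
      c'kv = off-core-≢ nE mK v∈core (branch≢centre akv cv) akv cv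
      c'ku : c' ≢ ku
      c'ku = off-core-≢ nE mK u∈core (branch≢centre aku cu) aku cu
      toward-e : (Σ V λ g → Nbr m' g × Branch m' g e) → ⊥
      toward-e (g , ag , cg) = toward-ku-or-not ag cg (g ≟F ku)
        where
        toward-ku-or-not : ∀ {g} → Nbr m' g → Branch m' g e → Dec (g ≡ ku) → ⊥
        toward-ku-or-not ag cg (yes refl) =
          path-degree≤2 P1 E1c E1kv (path-edge-toward P1 (edge-on₁ P1 E1c) eP1 em ag cg) c'kv c'ku (λ q → ne (sym q))
        toward-ku-or-not ag cg (no gk) =
          K₄P₄Rep.n12 h m' (c' , kv , ku , c'kv , c'ku , (λ q → ne (sym q)) , inj₁ E1c , inj₁ E1kv ,
            inj₂ (proj₁ (path-edges-toward P2 u∈P₂ eP2 (branch≢centre aku cu) em aku ag (λ q → gk (sym q)) cu cg)))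

    P₁-hanging-inner⇒⊥ : ∀ {b m' c'} → OnPath P1 b → OnPath core m' → Nbr m' c' → ¬ EdgeOf core m' c' → Branch m' c' b →
                         Separates m' u v → ⊥
    P₁-hanging-inner⇒⊥ {m' = m'} {c'} bP1 mK ac' nE cc' (ku , kv , aku , akv , ne , cu , cv) =
      P₁-hanging-with-edges⇒⊥ mK ac' nE aku akv ne cu cv (proj₁ E) (proj₂ E) (common₁₂ m')
      where
      E : EdgeOf P1 m' c' × EdgeOf P1 m' kv
      E = path-edges-toward P1 bP1 v∈P₁ (branch≢centre ac' cc') (branch≢centre akv cv) ac' akv
                            (off-core-≢ nE mK v∈core (branch≢centre akv cv) akv cv) cc' cv

    P₁-toward-u-on-core : ∀ {b k} → OnPath P1 b → b ≢ v → Nbr v k → Branch v k b → Branch v k u → Between u v b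
    P₁-toward-u-on-core {b} {k} bP1 bv ak ck cku = on-core-unless-hanging hanging⇒⊥
      where
      hanging⇒⊥ : ∀ {m' c'} → Between u v m' → Nbr m' c' → ¬ EdgeOf core m' c' → Branch m' c' b → ⊥
      hanging⇒⊥ (inj₁ refl) ac' nE cc' =
        off-edge-toward⇒⊥ {core} nE ac' cc' refl H.ay (H.side₁ bP1 (branch≢centre ac' cc')) core-u-edge
      hanging⇒⊥ (inj₂ (inj₁ refl)) ac' nE cc' =
        off-edge-toward⇒⊥ {core} nE ac' cc' refl ak ck (path-edge-toward core v∈core u∈core u≢v ak cku)
      hanging⇒⊥ (inj₂ (inj₂ s)) ac' nE cc' = P₁-hanging-inner⇒⊥ bP1 (between⇒core (inj₂ (inj₂ s))) ac' nE cc' s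

    P₁∩P₂-on-core : ∀ {b} → OnPath P1 b → OnPath P2 b → Between u v b
    P₁∩P₂-on-core {b} bP1 bP2 with b ≟F v
    ... | yes e = inj₂ (inj₁ e)
    ... | no bv = P₁-toward-u-on-core bP1 bv H'.ay (H'.side₁ bP2 bv) u∈Bv

    P₀-hanging-inner⇒⊥ : ∀ {t m' c'} → OnPath P0 t → OnPath core m' → Nbr m' c' → ¬ EdgeOf core m' c' → Branch m' c' t →
                         Separates m' u v → ⊥
    P₀-hanging-inner⇒⊥ {t} {m'} {c'} tP0 mK ac' nE cc' (ku , kv , aku , akv , ne , cu , cv) =
      split-at-m' (core-inner-edges aku akv ne cu cv)
      where
      c'ku : c' ≢ ku
      c'ku = off-core-≢ nE mK u∈core (branch≢centre aku cu) aku cu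
      c'kv : c' ≢ kv
      c'kv = off-core-≢ nE mK v∈core (branch≢centre akv cv) akv cv
      E : EdgeOf P0 m' ku × EdgeOf P0 m' c'
      E = path-edges-toward P0 u∈P₀ tP0 (branch≢centre aku cu) (branch≢centre ac' cc') aku ac' (λ q → c'ku (sym q)) cu cc'
      split-at-m' : (Σ V λ g → g ≢ kv × EdgeOf P1 m' kv × EdgeOf P1 m' g) ⊎ (EdgeOf P2 m' ku × EdgeOf P2 m' kv) → ⊥
      split-at-m' (inj₁ (_ , _ , E1kv , _)) = K₄P₄Rep.n01 h m' (ku , c' , kv , (λ q → c'ku (sym q)) , ne , c'kv ,
                                                              inj₁ (proj₁ E) , inj₁ (proj₂ E) , inj₂ E1kv)
      split-at-m' (inj₂ (_ , E2kv)) = branch≢centre aku cu (sym (split₀₂-unique (ku , c' , kv , (λ q → c'ku (sym q)) , ne , c'kv ,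
                                                              inj₁ (proj₁ E) , inj₁ (proj₂ E) , inj₂ E2kv)))

    P₀-on-core : ∀ {t} → OnPath P0 t → Branch u H.y t → Branch v H'.y t → Between u v t
    P₀-on-core {t} tP0 cyt cqt = on-core-unless-hanging hanging⇒⊥
      where
      hanging⇒⊥ : ∀ {m' c'} → Between u v m' → Nbr m' c' → ¬ EdgeOf core m' c' → Branch m' c' t → ⊥
      hanging⇒⊥ (inj₁ refl) ac' nE cc' = off-edge-toward⇒⊥ {core} nE ac' cc' refl H.ay cyt core-u-edge
      hanging⇒⊥ (inj₂ (inj₁ refl)) ac' nE cc' = off-edge-toward⇒⊥ {core} nE ac' cc' refl H'.ay cqt core-v-edge
      hanging⇒⊥ (inj₂ (inj₂ s)) ac' nE cc' = P₀-hanging-inner⇒⊥ tP0 (between⇒core (inj₂ (inj₂ s))) ac' nE cc' s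

    core⊆P₁∪P₂ : ∀ {m} → Between u v m → OnPath P1 m ⊎ OnPath P2 m
    core⊆P₁∪P₂ (inj₁ refl) = inj₂ u∈P₂
    core⊆P₁∪P₂ (inj₂ (inj₁ refl)) = inj₁ v∈P₁
    core⊆P₁∪P₂ (inj₂ (inj₂ (ku , kv , aku , akv , ne , cu , cv))) = go (core-inner-edges aku akv ne cu cv)
      where
      go : ∀ {m} → (Σ V λ g → g ≢ kv × EdgeOf P1 m kv × EdgeOf P1 m g) ⊎ (EdgeOf P2 m ku × EdgeOf P2 m kv) → OnPath P1 m ⊎ OnPath P2 m
      go (inj₁ (g , _ , E1 , _)) = inj₁ (edge-on₁ P1 E1)
      go (inj₂ (E2 , _)) = inj₂ (edge-on₁ P2 E2)

    edge∪-sym : ∀ {a b} → EdgeOf∪ P1 P2 a b → EdgeOf∪ P1 P2 b a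
    edge∪-sym (inj₁ e) = inj₁ (edge-sym {P1} e)
    edge∪-sym (inj₂ e) = inj₂ (edge-sym {P2} e)

    nbr-P₁-P₂⇒edge∪ : ∀ {a b} → OnPath P1 a → OnPath P2 b → Nbr a b → EdgeOf∪ P1 P2 a b
    nbr-P₁-P₂⇒edge∪ {a} {b} aP1 bP2 ab = go (common₁₂ a)
      where
      go2 : ∀ {e g} → OnPath P1 e → OnPath P2 e → e ≢ a → Nbr a g → Branch a g e → Dec (g ≡ b) → EdgeOf∪ P1 P2 a b
      go2 eP1 eP2 ea ag cg (yes refl) = inj₁ (path-edge-toward P1 aP1 eP1 ea ag cg)
      go2 eP1 eP2 ea ag cg (no gb) = inj₂ (proj₁ (path-edges-toward P2 bP2 eP2 (λ q → nbr-irrefl ab (sym q)) ea ab ag (λ q → gb (sym q)) here cg))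
      go : (Σ V λ e → OnPath P1 e × OnPath P2 e × e ≢ a) → EdgeOf∪ P1 P2 a b
      go (e , eP1 , eP2 , ea) = go' (branch-exists ea)
        where
        go' : (Σ V λ g → Nbr a g × Branch a g e) → EdgeOf∪ P1 P2 a b
        go' (g , ag , cg) = go2 eP1 eP2 ea ag cg (g ≟F b)

    nbr-on-P₁∪P₂⇒edge∪ : ∀ {a b} → OnPath P1 a ⊎ OnPath P2 a → OnPath P1 b ⊎ OnPath P2 b → Nbr a b → EdgeOf∪ P1 P2 a b
    nbr-on-P₁∪P₂⇒edge∪ (inj₁ a1) (inj₁ b1) ab = inj₁ (path-nbr⇒edge P1 a1 b1 ab)
    nbr-on-P₁∪P₂⇒edge∪ (inj₂ a2) (inj₂ b2) ab = inj₂ (path-nbr⇒edge P2 a2 b2 ab)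
    nbr-on-P₁∪P₂⇒edge∪ (inj₁ a1) (inj₂ b2) ab = nbr-P₁-P₂⇒edge∪ a1 b2 ab
    nbr-on-P₁∪P₂⇒edge∪ (inj₂ a2) (inj₁ b1) ab = edge∪-sym (nbr-P₁-P₂⇒edge∪ b1 a2 (nbr-sym ab))

    P₀-off-side : ∀ {a b} → EdgeOf P0 a b → ¬ EdgeOf∪ P1 P2 a b → (a ≡ u ⊎ Branch u H.x a) ⊎ Branch v H'.z a
    P₀-off-side {a} {b} e nU = at-u? (a ≟F u)
      where
      aP0 : OnPath P0 a
      aP0 = edge-on₁ P0 e
      bP0 : OnPath P0 b
      bP0 = edge-on₂ P0 e
      P₁-ray-at-v : ∀ {c} → c ≡ H'.y ⊎ c ≡ H'.z → EdgeOf P1 v c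
      P₁-ray-at-v (inj₁ r) = subst (EdgeOf P1 v) (sym r) H'.e2y
      P₁-ray-at-v (inj₂ r) = subst (EdgeOf P1 v) (sym r) H'.e2z
      along-core⇒⊥ : a ≢ u → a ≢ v → Branch u H.y a → Branch v H'.y a → Dec (b ≡ u) → Dec (b ≡ v) → ⊥
      along-core⇒⊥ au av cy cq (yes q) _ = nU (inj₂ (subst (EdgeOf P2 a) (sym q) (edge-sym {P2} (subst (EdgeOf P2 u) (sym ay) H.e2y))))
        where
        ay : a ≡ H.y
        ay = branch-unique (subst (λ k → Nbr k a) q (nbr-sym (edge-nbr P0 e))) H.ay here cy
      along-core⇒⊥ au av cy cq (no _) (yes q) =
        nU (inj₁ (edge-sym {P1} (subst (λ k → EdgeOf P1 k a) (sym q) (P₁-ray-at-v (H'.nbr₃ (subst (λ k → EdgeOf P0 k a) q (edge-sym {P0} e)))))))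
      along-core⇒⊥ au av cy cq (no bu) (no bv) =
        nU (nbr-on-P₁∪P₂⇒edge∪ (core⊆P₁∪P₂ (P₀-on-core aP0 cy cq))
                  (core⊆P₁∪P₂ (P₀-on-core bP0 (reach-trans cy (there (edge-nbr P0 e , au , bu) here)) (reach-trans cq (there (edge-nbr P0 e , av , bv) here))))
                  (edge-nbr P0 e))
      by-side₃ : a ≢ u → a ≢ v → Branch u H.y a → Branch v H'.y a ⊎ Branch v H'.z a → (a ≡ u ⊎ Branch u H.x a) ⊎ Branch v H'.z a
      by-side₃ au av cy (inj₂ cz) = inj₂ cz
      by-side₃ au av cy (inj₁ cq) = ⊥-elim (along-core⇒⊥ au av cy cq (b ≟F u) (b ≟F v))
      at-v? : a ≢ u → Branch u H.y a → Dec (a ≡ v) → (a ≡ u ⊎ Branch u H.x a) ⊎ Branch v H'.z a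
      at-v? au cy (yes q) = ⊥-elim (nU (inj₁ (subst (λ k → EdgeOf P1 k b) (sym q) (P₁-ray-at-v (H'.nbr₃ (subst (λ k → EdgeOf P0 k b) q e))))))
      at-v? au cy (no av) = by-side₃ au av cy (H'.side₃ aP0 av)
      by-side₀ : a ≢ u → Branch u H.x a ⊎ Branch u H.y a → (a ≡ u ⊎ Branch u H.x a) ⊎ Branch v H'.z a
      by-side₀ au (inj₁ cx) = inj₁ (inj₂ cx)
      by-side₀ au (inj₂ cy) = at-v? au cy (a ≟F v)
      at-u? : Dec (a ≡ u) → (a ≡ u ⊎ Branch u H.x a) ⊎ Branch v H'.z a
      at-u? (yes q) = inj₁ (inj₁ q)
      at-u? (no au) = by-side₀ au (H.side₀ aP0 au)

    P₁-between-ends : ∀ {α β m} → (α ≡ Path.first P1 ⊎ α ≡ Path.final P1) → Separates v α u → OnPath P2 β → Separates u β v →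
          OnPath P1 m → Between α β m
    P₁-between-ends {α} {β} {m} ep Sα@(k1 , k2 , a1 , a2 , ne12 , c1 , c2) βP2 Sβ@(kβ , kv' , aβ , av' , neβ , cβ , cv') mP1 =
      at-α? (m ≟F α)
      where
      k2q : k2 ≡ H'.y
      k2q = branch-unique a2 H'.ay c2 u∈Bv
      kv'y : kv' ≡ H.y
      kv'y = branch-unique av' H.ay cv' v∈Bu
      αv : α ≢ v
      αv = separates-≢₁ Sα
      αu : α ≢ u
      αu = separates-≢ Sα
      βv : β ≢ v
      βv = separates-≢ Sβ
      αP1 : OnPath P1 α
      αP1 = end-on P1 ep
      end-not-inside : (α ≡ Path.first P1 ⊎ α ≡ Path.final P1) → Inside (Path.verts P1) α m v → ⊥
      end-not-inside (inj₁ q) md = head-not-inside (Path.unique P1) (subst (λ k → Inside (Path.verts P1) k m v) q md)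
      end-not-inside (inj₂ q) md = last-not-inside (Path.unique P1) (sym q) md
      β∈Bv : Branch v H'.y β
      β∈Bv = H'.side₁ βP2 βv
      α∈Bu : Branch u H.y α
      α∈Bu = H.side₁ αP1 αu
      via-core : m ≢ v → Branch v H'.y m → Between u v m → Between α β m
      via-core mv m∈Bv (inj₁ q) = inj₂ (inj₂ (subst (λ k → Separates k α β) (sym q)
                             (H.y , kβ , H.ay , aβ , (λ e → neβ (trans (sym e) (sym kv'y))) , α∈Bu , cβ)))
      via-core mv m∈Bv (inj₂ (inj₁ q)) = ⊥-elim (mv q)
      via-core mv m∈Bv (inj₂ (inj₂ S@(ku , kv , aku , akv , ne , cu , cv))) =
        inj₂ (inj₂ (kv , ku , akv , aku , (λ e → ne (sym e)) , reach-trans cv (branch-around a1 c1 nk1m mv) , reach-trans cu (branch-around aβ cβ nkβm mu')))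
        where
        nk1m : ¬ Branch v k1 m
        nk1m c = ne12 (trans (branch-unique a1 H'.ay c m∈Bv) (sym k2q))
        mu' : m ≢ u
        mu' e = separates-≢₁ S (sym e)
        nkβm : ¬ Branch u kβ m
        nkβm c = neβ (trans (branch-unique aβ H.ay c (H.side₁ mP1 mu')) (sym kv'y))
      beyond-v : α ≢ m → m ≢ v → Branch v H'.z α → Branch v H'.z m →
           Inside (Path.verts P1) α m v ⊎ Inside (Path.verts P1) m α v ⊎ Inside (Path.verts P1) v α m → Between α β m
      beyond-v αm mv α∈Bv-z m∈Bv-z (inj₁ md) = ⊥-elim (end-not-inside ep md)
      beyond-v αm mv α∈Bv-z m∈Bv-z (inj₂ (inj₁ md)) with inside⇒separates P1 md
      ... | kα , kv , akα , akv , ne , cα , cv =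
        inj₂ (inj₂ (kα , kv , akα , akv , ne , cα , reach-trans cv (branch-around H'.ay β∈Bv (λ c → H'.yz (branch-unique H'.ay H'.az c m∈Bv-z)) mv)))
      beyond-v αm mv α∈Bv-z m∈Bv-z (inj₂ (inj₂ md)) = ⊥-elim (same-branch-¬separates H'.az α∈Bv-z m∈Bv-z (inside⇒separates P1 md))
      by-ray-at-v : α ≢ m → m ≢ v → ∀ {d} → Nbr v d → Branch v d m → Dec (d ≡ H'.y) → Between α β m
      by-ray-at-v αm mv ad cd (yes dq) = via-core mv m∈Bv (P₁-toward-u-on-core mP1 mv H'.ay m∈Bv u∈Bv)
        where
        m∈Bv : Branch v H'.y m
        m∈Bv = subst (λ k → Branch v k m) dq cd
      by-ray-at-v αm mv {d} ad cd (no dq) = beyond-v αm mv α∈Bv-z m∈Bv-z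
           (one-inside (Path.unique P1) (Path.linked P1) αP1 mP1 v∈P₁ αm αv mv)
        where
        m∈Bv-z : Branch v H'.z m
        m∈Bv-z with H'.side₂ mP1 mv
        ... | inj₁ c = ⊥-elim (dq (branch-unique ad H'.ay cd c))
        ... | inj₂ c = c
        α∈Bv-z : Branch v H'.z α
        α∈Bv-z with H'.side₂ αP1 αv
        ... | inj₁ c = ⊥-elim (ne12 (trans (branch-unique a1 H'.ay c1 c) (sym k2q)))
        ... | inj₂ c = c
      at-v? : α ≢ m → Dec (m ≡ v) → Between α β m
      at-v? αm (yes q) = inj₂ (inj₂ (subst (λ k → Separates k α β) (sym q)
                        (k1 , k2 , a1 , a2 , ne12 , c1 , subst (λ k → Branch v k β) (sym k2q) β∈Bv)))
      at-v? αm (no mv) with branch-exists mv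
      ... | d , ad , cd = by-ray-at-v αm mv ad cd (d ≟F H'.y)
      at-α? : Dec (m ≡ α) → Between α β m
      at-α? (yes q) = inj₁ q
      at-α? (no mα) = at-v? (λ e → mα (sym e)) (m ≟F v)

  module Sides {P0 P1 P2 P3 : Path T} (h : K₄P₄Rep P0 P1 P2 P3) {u : V} (su : Split P0 P2 u)
               {v : V} (sv : Split P1 P3 v) where
    open Core h su sv public
    private
      module B = Core (reverse h) (split-sym {P1} {P3} sv) (split-sym {P0} {P2} su)

    split₁₃-unique : ∀ {w} → Split P1 P3 w → w ≡ v
    split₁₃-unique s = B.split₀₂-unique (split-sym {P1} {P3} s)

    P₁-¬crosses-u : ¬ Crosses P1 u
    P₁-¬crosses-u c with crosses⇒two-edges P1 c
    ... | a , b , ne , e1 , e2 = ne (trans (H.nbr₁ e1) (sym (H.nbr₁ e2)))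

    P₂-¬crosses-v : ¬ Crosses P2 v
    P₂-¬crosses-v c with crosses⇒two-edges P2 c
    ... | a , b , ne , e1 , e2 = ne (trans (H'.nbr₁ e1) (sym (H'.nbr₁ e2)))

    P₁∩P₂⊆core : ∀ {a b} → EdgeOf P1 a b → EdgeOf P2 a b → EdgeOf core a b
    P₁∩P₂⊆core e1 e2 =
      path-nbr⇒edge core (between⇒core (P₁∩P₂-on-core (edge-on₁ P1 e1) (edge-on₁ P2 e2)))
                      (between⇒core (P₁∩P₂-on-core (edge-on₂ P1 e1) (edge-on₂ P2 e2))) (edge-nbr P1 e1)

    edge∪₀₃⇒edge∪₁₃ : ∀ {w kv g} → g ≢ kv → EdgeOf P1 w kv → EdgeOf P1 w g → ∀ {t} → EdgeOf∪ P0 P3 w t → EdgeOf∪ P1 P3 w t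
    edge∪₀₃⇒edge∪₁₃ gk E1kv E1g (inj₂ e3) = inj₂ e3
    edge∪₀₃⇒edge∪₁₃ {w} {kv} {g} gk E1kv E1g {t} (inj₁ e0) with ≡-or-≢ t kv g
    ... | inj₁ (inj₁ refl) = inj₁ E1kv
    ... | inj₁ (inj₂ refl) = inj₁ E1g
    ... | inj₂ (tk , tg) = ⊥-elim (K₄P₄Rep.n01 h w (t , kv , g , tk , tg , (λ q → gk (sym q)) , inj₁ e0 , inj₂ E1kv , inj₂ E1g))

    edge∪₀₃⇒edge∪₀₂ : ∀ {w ku kv} → ku ≢ kv → EdgeOf P2 w ku → EdgeOf P2 w kv → ∀ {t} → EdgeOf∪ P0 P3 w t → EdgeOf∪ P0 P2 w t
    edge∪₀₃⇒edge∪₀₂ ne E2ku E2kv (inj₁ e0) = inj₁ e0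
    edge∪₀₃⇒edge∪₀₂ {w} {ku} {kv} ne E2ku E2kv {t} (inj₂ e3) with ≡-or-≢ t ku kv
    ... | inj₁ (inj₁ refl) = inj₂ E2ku
    ... | inj₁ (inj₂ refl) = inj₂ E2kv
    ... | inj₂ (tu , tv) = ⊥-elim (K₄P₄Rep.n23 h w (ku , kv , t , ne , (λ q → tu (sym q)) , (λ q → tv (sym q)) ,
                                                    inj₁ E2ku , inj₁ E2kv , inj₂ e3))

    -- At an inner vertex w of the core, P₁ or P₂ uses two rays, which turns a split of P₀, P₃ at w
    -- into a second split of P₁, P₃ or of P₀, P₂.
    split₀₃-inner⇒⊥ : ∀ {w} → Split P0 P3 w → Separates w u v → ⊥
    split₀₃-inner⇒⊥ {w} s (ku , kv , aku , akv , ne , cu , cv) = two-rays (core-inner-edges aku akv ne cu cv)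
      where
      two-rays : (Σ V λ g → g ≢ kv × EdgeOf P1 w kv × EdgeOf P1 w g) ⊎ (EdgeOf P2 w ku × EdgeOf P2 w kv) → ⊥
      two-rays (inj₁ (g , gk , E1kv , E1g)) =
        branch≢centre akv cv (sym (split₁₃-unique (split-map {P0} {P3} {P1} {P3} (edge∪₀₃⇒edge∪₁₃ gk E1kv E1g) s)))
      two-rays (inj₂ (E2ku , E2kv)) =
        branch≢centre aku cu (sym (split₀₂-unique (split-map {P0} {P3} {P0} {P2} (edge∪₀₃⇒edge∪₀₂ ne E2ku E2kv) s)))

    split₀₃-at-u-or-v : ∀ {w} → Split P0 P3 w → w ≡ u ⊎ w ≡ v
    split₀₃-at-u-or-v {w} s = cases (w ≟F u) (w ≟F v)
      where
      w∈P₀ : OnPath P0 w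
      w∈P₀ = split-on {P0} {P3} s
      w∈P₃ : OnPath P3 w
      w∈P₃ = split-on {P3} {P0} (split-sym {P0} {P3} s)
      cases : Dec (w ≡ u) → Dec (w ≡ v) → w ≡ u ⊎ w ≡ v
      cases (yes e) _ = inj₁ e
      cases (no _) (yes e) = inj₂ e
      cases (no wu) (no wv) = ⊥-elim (split₀₃-inner⇒⊥ s (between⇒separates on-core wu wv))
        where
        on-core : Between u v w
        on-core = P₀-on-core w∈P₀ (branch-common (H.side₀ w∈P₀ wu) (H.side₃ w∈P₃ wu) H.ax H.az H.xz)
                                  (branch-common (H'.side₀ w∈P₃ wv) (H'.side₃ w∈P₀ wv) H'.ax H'.az H'.xz)

    -- A split of P₀, P₃ at u needs a third ray at u, which P₀ does not have, so P₃ uses it and also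
    -- passes through v; symmetrically at v.
    split₀₃-at-u⇒P₃-crosses : Split P0 P3 u → Crosses P3 u × Crosses P3 v
    split₀₃-at-u⇒P₃-crosses s = third-ray (split-other-neighbour {P0} {P3} s H.x H.y)
      where
      E3y : EdgeOf P3 u H.y
      E3y = path-edge-toward P3 (split-on {P3} {P0} (split-sym {P0} {P3} s)) v∈P₃ v≢u H.ay v∈Bu
      third-ray : (Σ V λ t → EdgeOf∪ P0 P3 u t × t ≢ H.x × t ≢ H.y) → Crosses P3 u × Crosses P3 v
      third-ray (t , inj₁ e0 , tx , ty) = ⊥-elim ([ tx , ty ]′ (H.nbr₀ e0))
      third-ray (t , inj₂ e3 , tx , ty) =
        two-edges⇒crosses P3 E3y e3 (λ q → ty (sym q)) , two-edges⇒crosses P3 H'.e0x H'.e0y H'.xy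

    split₀₃-at-v⇒P₀-crosses : Split P0 P3 v → Crosses P0 u × Crosses P0 v
    split₀₃-at-v⇒P₀-crosses s = third-ray (split-other-neighbour {P0} {P3} s H'.x H'.y)
      where
      E0y : EdgeOf P0 v H'.y
      E0y = path-edge-toward P0 (split-on {P0} {P3} s) u∈P₀ u≢v H'.ay u∈Bv
      third-ray : (Σ V λ t → EdgeOf∪ P0 P3 v t × t ≢ H'.x × t ≢ H'.y) → Crosses P0 u × Crosses P0 v
      third-ray (t , inj₂ e3 , tx , ty) = ⊥-elim ([ tx , ty ]′ (H'.nbr₀ e3))
      third-ray (t , inj₁ e0 , tx , ty) =
        two-edges⇒crosses P0 H.e0x H.e0y H.xy , two-edges⇒crosses P0 E0y e0 (λ q → ty (sym q))

    P₀-or-P₃-crosses-both : Σ V (Split P0 P3) → (Crosses P0 u × Crosses P0 v) ⊎ (Crosses P3 u × Crosses P3 v)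
    P₀-or-P₃-crosses-both (w , s) = at-u-or-v (split₀₃-at-u-or-v s)
      where
      at-u-or-v : w ≡ u ⊎ w ≡ v → (Crosses P0 u × Crosses P0 v) ⊎ (Crosses P3 u × Crosses P3 v)
      at-u-or-v (inj₁ e) = inj₂ (split₀₃-at-u⇒P₃-crosses (subst (Split P0 P3) e s))
      at-u-or-v (inj₂ e) = inj₁ (split₀₃-at-v⇒P₀-crosses (subst (Split P0 P3) e s))

    Off₁₂ : V → V → Set
    Off₁₂ x y = Nbr x y × ¬ EdgeOf∪ P1 P2 x y

    off₁₂-sym : ∀ {x y} → Off₁₂ x y → Off₁₂ y x
    off₁₂-sym (a , nU) = nbr-sym a , λ e → nU (edge∪-sym e)

    u-side : V → Set
    u-side a = a ≡ u ⊎ Branch u H.x a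

    v-side : V → Set
    v-side c = c ≡ v ⊎ Branch v H'.x c

    u-side-¬y : ∀ {a} → u-side a → ¬ Branch u H.y a
    u-side-¬y (inj₁ refl) c = branch≢centre H.ay c refl
    u-side-¬y (inj₂ cx) c = H.xy (branch-unique H.ax H.ay cx c)

    u-side-¬z : ∀ {a} → u-side a → ¬ Branch u H.z a
    u-side-¬z (inj₁ refl) c = branch≢centre H.az c refl
    u-side-¬z (inj₂ cx) c = H.xz (branch-unique H.ax H.az cx c)

    v-side-y : ∀ {c} → v-side c → Branch u H.y c
    v-side-y (inj₁ refl) = v∈Bu
    v-side-y (inj₂ cx) = reach-trans v∈Bu (branch-around H'.ax cx (λ k → H'.xy (branch-unique H'.ax H'.ay k u∈Bv)) u≢v)

    v-side-¬z : ∀ {c} → v-side c → ¬ Branch v H'.z c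
    v-side-¬z (inj₁ refl) k = branch≢centre H'.az k refl
    v-side-¬z (inj₂ cx) k = H'.xz (branch-unique H'.ax H'.az cx k)

    z-branch-at-v⊆y-branch-at-u : ∀ {a} → Branch v H'.z a → Branch u H.y a
    z-branch-at-v⊆y-branch-at-u cz = reach-trans v∈Bu (branch-around H'.az cz (λ k → H'.yz (branch-unique H'.ay H'.az u∈Bv k)) u≢v)

    -- every off-(P₁ ∪ P₂) walk stays on one side of the edges u–y, u–z of P₂ and v–z' of P₁
    sides-separated : ∀ {a c} → u-side a ⊎ Branch v H'.z a → v-side c ⊎ Branch u H.z c → ¬ Reach Off₁₂ a c
    sides-separated (inj₁ ua) (inj₁ vc) w = u-side-¬y ua (off-walk-keeps-branch (EdgeOf∪ P1 P2) (inj₂ H.e2y) H.ay w (v-side-y vc))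
    sides-separated (inj₁ ua) (inj₂ cz) w = u-side-¬z ua (off-walk-keeps-branch (EdgeOf∪ P1 P2) (inj₂ H.e2z) H.az w cz)
    sides-separated (inj₂ az) (inj₁ vc) w =
      v-side-¬z vc (off-walk-keeps-branch (EdgeOf∪ P1 P2) (inj₁ H'.e2z) H'.az (reach-sym off₁₂-sym w) az)
    sides-separated (inj₂ az) (inj₂ cz) w =
      H.yz (branch-unique H.ay H.az (z-branch-at-v⊆y-branch-at-u az) (off-walk-keeps-branch (EdgeOf∪ P1 P2) (inj₂ H.e2z) H.az w cz))

    P₀-P₃-separated : ∀ a b c d → EdgeOf P0 a b → ¬ EdgeOf∪ P1 P2 a b → EdgeOf P3 c d → ¬ EdgeOf∪ P1 P2 c d →
                      ¬ Reach Off₁₂ a c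
    P₀-P₃-separated a b c d e0 n0 e3 n3 =
      sides-separated (P₀-off-side e0 n0) (by-B (B.P₀-off-side e3 (λ e → n3 (edge∪-swap {P2} {P1} e))))
      where
      by-B : v-side c ⊎ Branch u (SplitStar.z B.H') c → v-side c ⊎ Branch u H.z c
      by-B (inj₁ vc) = inj₁ vc
      by-B (inj₂ cz) = inj₂ (subst (λ k → Branch u k c) (star-z-unique H B.H') cz)

    ends-≢ : ∀ {α β} → Separates v α u → OnPath P2 β → Separates u β v → α ≢ β
    ends-≢ {α} {β} (k1 , k2 , a1 , a2 , ne , c1 , c2) βP2 Sβ e =
      ne (trans (branch-unique a1 H'.ay c1 (subst (Branch v H'.y) (sym e) (H'.side₁ βP2 (separates-≢ Sβ))))
                (sym (branch-unique a2 H'.ay c2 u∈Bv)))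

    -- P₁ ∪ P₂ is the path R from the end α of P₁ beyond v to the end β of P₂ beyond u.
    module UnionPath {α β : V} (αe : α ≡ Path.first P1 ⊎ α ≡ Path.final P1) (Sα : Separates v α u)
                     (βe : β ≡ Path.first P2 ⊎ β ≡ Path.final P2) (Sβ : Separates u β v)
                     (R : Path T) (Rf : Path.first R ≡ α) (Rl : Path.final R ≡ β) where
      α∈P₁ : OnPath P1 α
      α∈P₁ = end-on P1 αe
      β∈P₂ : OnPath P2 β
      β∈P₂ = end-on P2 βe

      R⊆P₁∪P₂ : ∀ {m} → OnPath R m → OnPath P1 m ⊎ OnPath P2 m
      R⊆P₁∪P₂ {m} mR = on (path⇒between R Rf Rl mR) (m ∈? Path.verts P1) (m ∈? Path.verts P2)
        where
        on : Between α β m → Dec (OnPath P1 m) → Dec (OnPath P2 m) → OnPath P1 m ⊎ OnPath P2 m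
        on _ (yes p) _ = inj₁ p
        on _ (no _) (yes p) = inj₂ p
        on (inj₁ refl) (no n1) (no _) = ⊥-elim (n1 α∈P₁)
        on (inj₂ (inj₁ refl)) (no _) (no n2) = ⊥-elim (n2 β∈P₂)
        on (inj₂ (inj₂ (kα , kβ , akα , akβ , ne , cα , cβ))) (no n1) (no n2) =
          ⊥-elim (ne (branch-unique akα akβ (reach-trans cα (via-P₁∩P₂ (common-vertex-≢ {P1} {P2} (K₄P₄Rep.i12 h) m))) cβ))
          where
          via-P₁∩P₂ : (Σ V λ e → OnPath P1 e × OnPath P2 e × e ≢ m) → Reach (NbrAvoiding m) α β
          via-P₁∩P₂ (e , eP1 , eP2 , _) =
            reach-trans (avoiding-path-connected P1 n1 α∈P₁ eP1) (avoiding-path-connected P2 n2 eP2 β∈P₂)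

      P₁⊆R : ∀ {m} → OnPath P1 m → OnPath R m
      P₁⊆R mP = between⇒path R Rf Rl (P₁-between-ends αe Sα β∈P₂ Sβ mP)
      P₂⊆R : ∀ {m} → OnPath P2 m → OnPath R m
      P₂⊆R mP = between⇒path R Rf Rl (between-sym (B.P₁-between-ends βe Sβ α∈P₁ Sα mP))

      edge∪⇒R : ∀ {a b} → EdgeOf∪ P1 P2 a b → EdgeOf R a b
      edge∪⇒R (inj₁ e) = path-nbr⇒edge R (P₁⊆R (edge-on₁ P1 e)) (P₁⊆R (edge-on₂ P1 e)) (edge-nbr P1 e)
      edge∪⇒R (inj₂ e) = path-nbr⇒edge R (P₂⊆R (edge-on₁ P2 e)) (P₂⊆R (edge-on₂ P2 e)) (edge-nbr P2 e)

      R≡P₁∪P₂ : ∀ a b → EdgeOf R a b ⇔ EdgeOf∪ P1 P2 a b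
      R≡P₁∪P₂ a b = mk⇔ (λ e → nbr-on-P₁∪P₂⇒edge∪ (R⊆P₁∪P₂ (edge-on₁ R e)) (R⊆P₁∪P₂ (edge-on₂ R e)) (edge-nbr R e)) edge∪⇒R

      P₁∪P₂-crosses : Crosses∪ P1 P2 u × Crosses∪ P1 P2 v
      P₁∪P₂-crosses = (R , R≡P₁∪P₂ , two-edges⇒crosses R (edge∪⇒R (inj₂ H.e2y)) (edge∪⇒R (inj₂ H.e2z)) H.yz) ,
                      (R , R≡P₁∪P₂ , two-edges⇒crosses R (edge∪⇒R (inj₁ H'.e2y)) (edge∪⇒R (inj₁ H'.e2z)) H'.yz)

    P₁∪P₂-crosses-u-v : Crosses∪ P1 P2 u × Crosses∪ P1 P2 v
    P₁∪P₂-crosses-u-v = with-ends (end-away (inner-separates-ends P1 H'.e2y H'.e2z H'.yz) H'.ay u∈Bv)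
                                  (end-away (inner-separates-ends P2 H.e2y H.e2z H.yz) H.ay v∈Bu)
      where
      with-ends : (Σ V λ e → (e ≡ Path.first P1 ⊎ e ≡ Path.final P1) × Separates v e u) →
                  (Σ V λ e → (e ≡ Path.first P2 ⊎ e ≡ Path.final P2) × Separates u e v) → Crosses∪ P1 P2 u × Crosses∪ P1 P2 v
      with-ends (α , αe , Sα) (β , βe , Sβ) = union (path-between (ends-≢ Sα (end-on P2 βe) Sβ))
        where
        union : (Σ (Path T) λ R → Path.first R ≡ α × Path.final R ≡ β) → Crosses∪ P1 P2 u × Crosses∪ P1 P2 v
        union (R , Rf , Rl) = UnionPath.P₁∪P₂-crosses αe Sα βe Sβ R Rf Rl

    -- The end s of P₂ beyond u lies on the u–v path; its edge s–s' toward u is shared by all four paths.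
    module CommonEdge {s s' : V} (se : s ≡ Path.first P2 ⊎ s ≡ Path.final P2) (s∈By : Branch u H.y s)
                      (v∈P₀ : OnPath P0 v) (ss' : Nbr s s') (u∈Bs' : Branch s s' u) where
      s∈P₂ : OnPath P2 s
      s∈P₂ = end-on P2 se
      s≢u : s ≢ u
      s≢u = branch≢centre H.ay s∈By
      u≢s : u ≢ s
      u≢s e = s≢u (sym e)
      E2 : EdgeOf P2 s s'
      E2 = path-edge-toward P2 s∈P₂ u∈P₂ u≢s ss' u∈Bs'
      P₂-ray : ∀ {c} → EdgeOf P2 s c → Dec (c ≡ s') → c ≡ s'
      P₂-ray e (yes q) = q
      P₂-ray e (no ne) = ⊥-elim ([ proj₁ ends , proj₂ ends ]′ se)
        where
        ends : s ≢ Path.first P2 × s ≢ Path.final P2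
        ends = inner-not-end P2 e E2 ne
      P₂⊆Bs' : ∀ {t} → OnPath P2 t → t ≢ s → Branch s s' t
      P₂⊆Bs' {t} tP ts = toward-s' (branch-exists ts)
        where
        toward-s' : (Σ V λ d → Nbr s d × Branch s d t) → Branch s s' t
        toward-s' (d , ad , cd) = subst (λ k → Branch s k t) (P₂-ray (path-edge-toward P2 s∈P₂ tP ts ad cd) (d ≟F s')) cd
      s-on-core : Between u v s
      s-on-core = between-sym (B.P₁-toward-u-on-core s∈P₂ s≢u H.ay s∈By v∈Bu)
      shared : (Σ V λ e → OnPath P1 e × OnPath P2 e × e ≢ s) → (Σ V λ e → OnPath P2 e × OnPath P3 e × e ≢ s) →
               Dec (s ≡ v) → SharedEdge P0 P1 P2 P3
      shared (e1 , e1P1 , e1P2 , e1s) (e3 , e3P2 , e3P3 , e3s) (yes q) =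
        s , s' , path-edge-toward P0 (subst (OnPath P0) (sym q) v∈P₀) u∈P₀ u≢s ss' u∈Bs' ,
        path-edge-toward P1 (subst (OnPath P1) (sym q) v∈P₁) e1P1 e1s ss' (P₂⊆Bs' e1P2 e1s) , E2 ,
        path-edge-toward P3 (subst (OnPath P3) (sym q) v∈P₃) e3P3 e3s ss' (P₂⊆Bs' e3P2 e3s)
      shared (e1 , e1P1 , e1P2 , e1s) (e3 , e3P2 , e3P3 , e3s) (no s≢v) = toward-u-v (between⇒separates s-on-core s≢u s≢v)
        where
        v≢s : v ≢ s
        v≢s e = s≢v (sym e)
        toward-u-v : Separates s u v → SharedEdge P0 P1 P2 P3
        toward-u-v (ku , kv , aku , akv , ne , cu , cv) =
          s , s' , proj₁ (path-edges-toward P0 u∈P₀ v∈P₀ u≢s v≢s ss' akv s'≢kv u∈Bs' cv) ,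
          proj₁ (path-edges-toward P1 e1P1 v∈P₁ e1s v≢s ss' akv s'≢kv (P₂⊆Bs' e1P2 e1s) cv) , E2 ,
          proj₁ (path-edges-toward P3 e3P3 v∈P₃ e3s v≢s ss' akv s'≢kv (P₂⊆Bs' e3P2 e3s) cv)
          where
          s'≢kv : s' ≢ kv
          s'≢kv q = ne (trans (branch-unique aku ss' cu u∈Bs') q)
      edge : SharedEdge P0 P1 P2 P3
      edge = shared (common-vertex-≢ {P1} {P2} (K₄P₄Rep.i12 h) s) (common-vertex-≢ {P2} {P3} (K₄P₄Rep.i23 h) s) (s ≟F v)

    shared-edge-if-P₀∋v : OnPath P0 v → SharedEdge P0 P1 P2 P3
    shared-edge-if-P₀∋v v∈P₀ = from-end (end-toward (inner-separates-ends P2 H.e2y H.e2z H.yz) H.ay H.az H.yz ray₁ ray₂)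
      where
      ray₁ : ∀ {c} → Nbr u c → Branch u c (Path.first P2) → c ≡ H.y ⊎ c ≡ H.z
      ray₁ ac cc = H.nbr₂ (path-edge-toward P2 u∈P₂ (first-on P2) (branch≢centre ac cc) ac cc)
      ray₂ : ∀ {c} → Nbr u c → Branch u c (Path.final P2) → c ≡ H.y ⊎ c ≡ H.z
      ray₂ ac cc = H.nbr₂ (path-edge-toward P2 u∈P₂ (final-on P2) (branch≢centre ac cc) ac cc)
      from-end : (Σ V λ s → (s ≡ Path.first P2 ⊎ s ≡ Path.final P2) × Branch u H.y s) → SharedEdge P0 P1 P2 P3
      from-end (s , se , s∈By) = toward-u (branch-exists (λ e → branch≢centre H.ay s∈By (sym e)))
        where
        toward-u : (Σ V λ s' → Nbr s s' × Branch s s' u) → SharedEdge P0 P1 P2 P3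
        toward-u (s' , ss' , u∈Bs') = CommonEdge.edge se s∈By v∈P₀ ss' u∈Bs'

  shared-edge : ∀ {P0 P1 P2 P3 : Path T} → K₄P₄Rep P0 P1 P2 P3 → ∀ {u v} → Split P0 P2 u → Split P1 P3 v →
                Σ V (Split P0 P3) → SharedEdge P0 P1 P2 P3
  shared-edge {P0} {P1} {P2} {P3} h {u} {v} su sv s₀₃ = from-crossing (Sides.P₀-or-P₃-crosses-both h su sv s₀₃)
    where
    reorder : SharedEdge P3 P2 P1 P0 → SharedEdge P0 P1 P2 P3
    reorder (a , b , e3 , e2 , e1 , e0) = a , b , e0 , e1 , e2 , e3
    from-crossing : (Crosses P0 u × Crosses P0 v) ⊎ (Crosses P3 u × Crosses P3 v) → SharedEdge P0 P1 P2 P3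
    from-crossing (inj₁ (_ , P₀∋v)) = Sides.shared-edge-if-P₀∋v h su sv (crosses⇒on {P0} P₀∋v)
    from-crossing (inj₂ (P₃∋u , _)) =
      reorder (Sides.shared-edge-if-P₀∋v (reverse h) (split-sym {P1} {P3} sv) (split-sym {P0} {P2} su) (crosses⇒on {P3} P₃∋u))

  represents⇒K₄P₄Rep : (𝒫 : Fin 4 → Path T) → Represents 𝒫 K₄ P₄ →
                       K₄P₄Rep (𝒫 0F) (𝒫 1F) (𝒫 2F) (𝒫 3F)
  represents⇒K₄P₄Rep 𝒫 rep = record
    { i01 = intersect 0F 1F (λ ()) ; i02 = intersect 0F 2F (λ ()) ; i03 = intersect 0F 3F (λ ())
    ; i12 = intersect 1F 2F (λ ()) ; i13 = intersect 1F 3F (λ ()) ; i23 = intersect 2F 3F (λ ())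
    ; n01 = proj₂ (similar 0F 1F (λ ()) (inj₁ refl))
    ; n12 = proj₂ (similar 1F 2F (λ ()) (inj₁ refl))
    ; n23 = proj₂ (similar 2F 3F (λ ()) (inj₁ refl)) }
    where
    intersect : ∀ a b → a ≢ b → Intersect (𝒫 a) (𝒫 b)
    intersect a b ne = Equivalence.to (proj₁ (rep a b ne)) ne
    similar : ∀ a b → a ≢ b → P₄ a b → 𝒫 a ∼ 𝒫 b
    similar a b ne = Equivalence.to (proj₂ (rep a b ne))

  represents⇒split : (𝒫 : Fin 4 → Path T) → Represents 𝒫 K₄ P₄ → ∀ a b → a ≢ b → ¬ P₄ a b →
                     Σ V (Split (𝒫 a) (𝒫 b))
  represents⇒split 𝒫 rep a b ne ¬P₄ =
    split-of-¬∼ {𝒫 a} {𝒫 b} (Equivalence.to (proj₁ (rep a b ne)) ne) (λ s → ¬P₄ (Equivalence.from (proj₂ (rep a b ne)) s))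

lemma15 : ∀ {n : ℕ} (T : Tree n) (𝒫 : Fin 4 → Path T) →
    Represents 𝒫 K₄ P₄ →
    let P₀ = 𝒫 zero
        P₁ = 𝒫 (suc zero)
        P₂ = 𝒫 (suc (suc zero))
        P₃ = 𝒫 (suc (suc (suc zero)))
        ⋂𝒫 = λ x y → EdgeOf P₀ x y × EdgeOf P₁ x y × EdgeOf P₂ x y × EdgeOf P₃ x y
    in Σ (Path T) λ core → ∃[ u ] ∃[ v ] (Path.first core ≡ u × Path.final core ≡ v ×
      -- (i)
      ((∀ w → Split P₀ P₂ w ⇔ (w ≡ u)) × (∀ w → Split P₁ P₃ w ⇔ (w ≡ v)) ×
       ¬ Crosses P₁ u × ¬ Crosses P₂ v) ×
      -- (ii)
      ((∃[ x ] ∃[ y ] ⋂𝒫 x y) ×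
       (∀ x y → ⋂𝒫 x y → EdgeOf P₁ x y × EdgeOf P₂ x y) ×
       (∀ x y → EdgeOf P₁ x y → EdgeOf P₂ x y → EdgeOf core x y) ×
       u ≢ v) ×
      -- (iii)
      (((Crosses P₀ u × Crosses P₀ v) ⊎ (Crosses P₃ u × Crosses P₃ v)) ×
       (∃[ w ] Split P₀ P₃ w) ×
       (∀ w → Split P₀ P₃ w → (w ≡ u) ⊎ (w ≡ v))) ×
      -- (iv)
      (Crosses∪ P₁ P₂ u × Crosses∪ P₁ P₂ v) ×
      -- (v): in T minus the edges of P₁ ∪ P₂, no remaining edge of P₀ is
      -- connected to a remaining edge of P₃
      (∀ a b c d → EdgeOf P₀ a b → ¬ EdgeOf∪ P₁ P₂ a b →
                   EdgeOf P₃ c d → ¬ EdgeOf∪ P₁ P₂ c d →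
                   ¬ Reach (λ x y → Adj T x y × ¬ EdgeOf∪ P₁ P₂ x y) a c))
lemma15 {n} T 𝒫 rep =
  core , u , v , core-first , core-final ,
  ((λ w → mk⇔ split₀₂-unique (λ e → subst (Split P₀ P₂) (sym e) su)) ,
   (λ w → mk⇔ split₁₃-unique (λ e → subst (Split P₁ P₃) (sym e) sv)) , P₁-¬crosses-u , P₂-¬crosses-v) ,
  (shared-edge T h su sv s₀₃ , (λ { x y (_ , e₁ , e₂ , _) → e₁ , e₂ }) , (λ x y → P₁∩P₂⊆core) , u≢v) ,
  (P₀-or-P₃-crosses-both s₀₃ , s₀₃ , λ w → split₀₃-at-u-or-v) ,
  P₁∪P₂-crosses-u-v ,
  P₀-P₃-separated
  where
  P₀ P₁ P₂ P₃ : Path T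
  P₀ = 𝒫 0F
  P₁ = 𝒫 1F
  P₂ = 𝒫 2F
  P₃ = 𝒫 3F
  h : K₄P₄Rep T P₀ P₁ P₂ P₃
  h = represents⇒K₄P₄Rep T 𝒫 rep
  s₀₂ : Σ (Fin n) (Split P₀ P₂)
  s₀₂ = represents⇒split T 𝒫 rep 0F 2F (λ ()) λ { (inj₁ ()) ; (inj₂ ()) }
  s₁₃ : Σ (Fin n) (Split P₁ P₃)
  s₁₃ = represents⇒split T 𝒫 rep 1F 3F (λ ()) λ { (inj₁ ()) ; (inj₂ ()) }
  s₀₃ : Σ (Fin n) (Split P₀ P₃)
  s₀₃ = represents⇒split T 𝒫 rep 0F 3F (λ ()) λ { (inj₁ ()) ; (inj₂ ()) }
  u v : Fin n
  u = proj₁ s₀₂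
  v = proj₁ s₁₃
  su : Split P₀ P₂ u
  su = proj₂ s₀₂
  sv : Split P₁ P₃ v
  sv = proj₂ s₁₃
  open Sides T h su sv
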